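{- Let $G$ be a projective planar graph with girth at least $5$ that is not $(1,10)$-colorable, and which has the minimum number of vertices among all such graphs. If $v$ is a vertex of $G$ with $d(v)\le 11$, then $v$ is adjacent to at least one vertex of degree at least $12$.
   Context: All graphs are finite and simple; $d(v)$ denotes the degree of $v$. A graph $H$ is $(1,10)$-colorable if there is a map $\varphi:V(H)\to\{1,10\}$ such that for each $i\in\{1,10\}$ the subgraph induced by the vertices of color $i$ has maximum degree at most $i$. The girth is the length of a shortest cycle. A graph is projective planar if it embeds in the projective plane. -}

module Defs where

open import Data.Nat using (ℕ; _+_; _*_; _≤_)
open import Data.Fin using (Fin)
open import Data.Bool using (Bool; true; false; if_then_else_; _∧_)
open import Data.List using (map; allFin)
open import Data.Nat.ListAction using (sum)
open import Data.Product using (Σ; ∃; _×_)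
open import Data.Sum using (_⊎_)
open import Relation.Nullary using (¬_)
open import Relation.Binary.PropositionalEquality using (_≡_; _≢_)
open import Relation.Binary.Construct.Closure.ReflexiveTransitive using (Star)

record Graph : Set where
  field
    n      : ℕ
    adj    : Fin n → Fin n → Bool
    sym    : ∀ u v → adj u v ≡ adj v u
    irrefl : ∀ v → adj v v ≡ false
open Graph public

deg : (G : Graph) → Fin (n G) → ℕ
deg G v = sum (map (λ u → if adj G v u then 1 else 0) (allFin (n G)))

-- girth ≥ 5: no cycle of length 3 and no cycle of length 4
-- (distinctness of consecutive vertices follows from irreflexivity)
GirthAtLeast5 : Graph → Set
GirthAtLeast5 G =
  (∀ a b c → adj G a b ≡ true → adj G b c ≡ true → adj G c a ≡ false)
  × (∀ a b c d → a ≢ c → b ≢ d →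
       adj G a b ≡ true → adj G b c ≡ true → adj G c d ≡ true →
       adj G d a ≡ false)

data Color : Set where
  c1 c10 : Color

cap : Color → ℕ
cap c1  = 1
cap c10 = 10

_==ᶜ_ : Color → Color → Bool
c1  ==ᶜ c1  = true
c10 ==ᶜ c10 = true
_   ==ᶜ _   = false

colorDeg : (G : Graph) → (Fin (n G) → Color) → Fin (n G) → ℕ
colorDeg G φ v =
  sum (map (λ u → if adj G v u ∧ (φ u ==ᶜ φ v) then 1 else 0) (allFin (n G)))

Colorable-1-10 : Graph → Set
Colorable-1-10 G =
  Σ (Fin (n G) → Color) λ φ → ∀ v → colorDeg G φ v ≤ cap (φ v)

-- Projective planarity, via combinatorial maps (graph-encoded maps /
-- flag systems).  A map is a finite set of flags with fixed-point-free
-- involutions t0 (change vertex), t1 (change edge), t2 (change face),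
-- with t0 t2 = t2 t0 fixed-point-free.  Vertices, edges, faces and
-- components are the orbits of <t1,t2>, <t0,t2>, <t0,t1>, <t0,t1,t2>.

record Map : Set where
  field
    m      : ℕ
    t0 t1 t2 : Fin m → Fin m
    inv0   : ∀ x → t0 (t0 x) ≡ x
    inv1   : ∀ x → t1 (t1 x) ≡ x
    inv2   : ∀ x → t2 (t2 x) ≡ x
    fpf0   : ∀ x → t0 x ≢ x
    fpf1   : ∀ x → t1 x ≢ x
    fpf2   : ∀ x → t2 x ≢ x
    comm02 : ∀ x → t0 (t2 x) ≡ t2 (t0 x)
    fpf02  : ∀ x → t0 (t2 x) ≢ x
open Map public

Step₂ : ∀ {k} → (Fin k → Fin k) → (Fin k → Fin k) → Fin k → Fin k → Set
Step₂ f g x y = (f x ≡ y) ⊎ (g x ≡ y)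

Step₃ : ∀ {k} → (Fin k → Fin k) → (Fin k → Fin k) → (Fin k → Fin k) →
        Fin k → Fin k → Set
Step₃ f g h x y = (f x ≡ y) ⊎ ((g x ≡ y) ⊎ (h x ≡ y))

NumClasses : ∀ {k} → (Fin k → Fin k → Set) → ℕ → Set
NumClasses {k} R c =
  Σ (Fin k → Fin c) λ f →
    (∀ j → ∃ λ x → f x ≡ j)
    × (∀ x y → (f x ≡ f y → R x y) × (R x y → f x ≡ f y))

VertexOrb EdgeOrb FaceOrb CompOrb : (M : Map) → Fin (m M) → Fin (m M) → Set
VertexOrb M = Star (Step₂ (t1 M) (t2 M))
EdgeOrb   M = Star (Step₂ (t0 M) (t2 M))
FaceOrb   M = Star (Step₂ (t0 M) (t1 M))
CompOrb   M = Star (Step₃ (t0 M) (t1 M) (t2 M))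

-- total Euler genus  2·(#components) − V + E − F  is at most 1
EulerGenusAtMost1 : Map → Set
EulerGenusAtMost1 M =
  Σ ℕ λ V → Σ ℕ λ E → Σ ℕ λ F → Σ ℕ λ k →
    NumClasses (VertexOrb M) V × NumClasses (EdgeOrb M) E
    × NumClasses (FaceOrb M) F × NumClasses (CompOrb M) k
    × (2 * k + E ≤ 1 + V + F)

-- M is a map whose underlying graph is G with its isolated vertices
-- removed; vtx assigns to each flag its vertex of G.
Realizes : (M : Map) (G : Graph) → (Fin (m M) → Fin (n G)) → Set
Realizes M G vtx =
  (∀ x y → (vtx x ≡ vtx y → VertexOrb M x y) × (VertexOrb M x y → vtx x ≡ vtx y))
  × (∀ x → adj G (vtx x) (vtx (t0 M x)) ≡ true)
  × (∀ u v → adj G u v ≡ true → ∃ λ x → (vtx x ≡ u) × (vtx (t0 M x) ≡ v))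
  × (∀ x y → vtx x ≡ vtx y → vtx (t0 M x) ≡ vtx (t0 M y) → EdgeOrb M x y)

-- G embeds in the projective plane: every component is cellularly
-- embedded in the sphere or the projective plane, at most one of them
-- non-planar (isolated vertices are trivially embedded).
ProjectivePlanar : Graph → Set
ProjectivePlanar G =
  Σ Map λ M → Σ (Fin (m M) → Fin (n G)) λ vtx →
    Realizes M G vtx × EulerGenusAtMost1 M

Bad : Graph → Set
Bad G = ProjectivePlanar G × GirthAtLeast5 G × ¬ Colorable-1-10 G

-- If v and all its neighbours had degree at most 11, then G − v would be projective planar,
-- of girth at least 5 and smaller than G, hence (1,10)-colourable by minimality; and such a
-- colouring extends to G.  If every neighbour of v has colour 10, v gets colour 1.  Otherwise v
-- gets colour 10 and every neighbour with ten neighbours of colour 10 is recoloured 1: such a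
-- neighbour has degree at most 10 in G − v, so all its neighbours have colour 10, and no two of
-- them are adjacent because G has no triangles.
--
-- G is the underlying graph of a
-- combinatorial map of Euler genus at most 1, and the edges at v are deleted one at a time: the
-- half-edges at both ends of the edge are detached from their vertices, which adds a vertex and
-- changes faces and components without increasing the Euler genus (a parity argument shows that
-- when a component splits, a face splits too), and the resulting one-edge component is cut out.
-- Orbit counts exist only classically, so this part runs in the double-negation monad; the
-- conclusion is decidable, so nothing is lost.

module Submission where

open import Defs renaming (sym to adj-sym)

open import Data.Bool using (Bool; true; false; _∧_; not; if_then_else_)
import Data.Bool as Bool
open import Data.Bool.Properties using (∧-identityʳ; ∧-zeroʳ)
open import Data.Empty using (⊥-elim)
open import Data.Fin using (Fin; zero; suc; _≟_; join; splitAt; punchIn; punchOut)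
open import Data.Fin.Properties
  using (injective⇒≤; any?; splitAt-join; suc-injective; ¬Fin0; toℕ<n; punchInᵢ≢i; punchIn-injective;
         punchIn-punchOut; punchOut-punchIn; punchOut-cong; punchOut-injective)
open import Data.List using (allFin)
import Data.List as List
open import Data.List.Properties using (map-tabulate)
open import Data.Nat using (ℕ; zero; suc; _+_; _*_; _≤_; _<_; z≤n; s≤s; _≤?_)
open import Data.Nat.Divisibility using (_∣_; _∣0; ∣-refl; ∣m∣n⇒∣m+n; ∣m+n∣m⇒∣n; ∣1⇒≡1)
open import Data.Nat.ListAction using (sum)
open import Data.Nat.Properties
  using (+-0-commutativeMonoid; +-comm; +-suc; +-mono-≤; +-monoˡ-≤; +-monoʳ-≤; +-mono-<-≤; +-mono-≤-<;
         *-monoʳ-≤; +-cancelʳ-≤; ≤-refl; ≤-reflexive; ≤-trans; ≰⇒>; 1+n≰n; module ≤-Reasoning)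
import Data.Nat.Properties as ℕ
open import Algebra.Properties.CommutativeMonoid.Sum +-0-commutativeMonoid
  using (sum-remove; sum-cong-≗; sum-replicate-zero) renaming (sum to ∑)
open import Data.Nat.Solver using (module +-*-Solver)
open +-*-Solver using (solve; _:=_; _:+_; _:*_; con)
open import Data.Product using (Σ; ∃; _×_; _,_; proj₁; proj₂)
open import Data.Sum using (_⊎_; inj₁; inj₂)
open import Data.Sum.Properties using (inj₁-injective; inj₂-injective)
open import Effect.Monad using (RawMonad)
open import Function using (_∘_; id; flip)
open import Function.Bundles using (mk⇔)
open import Level using (0ℓ)
open import Relation.Binary using (Rel; IsEquivalence; Decidable; Symmetric; _⇒_)
open import Relation.Binary.Construct.Closure.ReflexiveTransitive using (Star; ε; _◅_; _◅◅_; fold; gmap; reverse)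
open import Relation.Binary.PropositionalEquality
  using (_≡_; _≢_; refl; sym; trans; cong; cong₂; subst; subst₂; module ≡-Reasoning)
open import Relation.Nullary using (¬_; Dec; yes; no; contradiction)
import Relation.Nullary.Decidable as Dec
open import Relation.Nullary.Decidable
  using (does; dec-true; dec-false; does-⇔; decidable-stable; ¬¬-excluded-middle; _⊎-dec_; _×-dec_)
open import Relation.Nullary.Negation using (DoubleNegation; ¬¬-Monad)

open RawMonad (¬¬-Monad {0ℓ}) using (_>>=_; pure)

private
  variable
    k k′ c d e : ℕ

-- Counting equivalence classes

module Classes {R : Rel (Fin k) 0ℓ} (N : NumClasses R c) where

  classOf : Fin k → Fin c
  classOf = proj₁ N

  repr : Fin c → Fin k
  repr j = proj₁ (proj₁ (proj₂ N) j)

  classOf-repr : ∀ j → classOf (repr j) ≡ j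
  classOf-repr j = proj₂ (proj₁ (proj₂ N) j)

  sameClass⇒R : ∀ {x y} → classOf x ≡ classOf y → R x y
  sameClass⇒R = proj₁ (proj₂ (proj₂ N) _ _)

  R⇒sameClass : ∀ {x y} → R x y → classOf x ≡ classOf y
  R⇒sameClass = proj₂ (proj₂ (proj₂ N) _ _)

  R? : Decidable R
  R? x y = Dec.map′ sameClass⇒R R⇒sameClass (classOf x ≟ classOf y)

open Classes public

classes-≥ : {R : Rel (Fin k) 0ℓ} (x : Fin d → Fin k) →
            (∀ {i j} → R (x i) (x j) → i ≡ j) → NumClasses R c → d ≤ c
classes-≥ x separated N = injective⇒≤ (separated ∘ sameClass⇒R N)

classes-≤ : {R : Rel (Fin k) 0ℓ} → IsEquivalence R → (a : Fin d → Fin k) →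
            (label : ∀ y → (∀ i → ¬ R y (a i)) → Fin e) →
            (∀ {y y′} ny ny′ → label y ny ≡ label y′ ny′ → R y y′) →
            NumClasses R c → c ≤ d + e
classes-≤ {d = d} {e = e} {R = R} isEq a label label-reflects N =
  injective⇒≤ {f = join d e ∘ h} (h-injective ∘ join-injective)
  where
  open IsEquivalence isEq using () renaming (sym to ∼-sym; trans to ∼-trans)
  join-injective : ∀ {i j} → join d e i ≡ join d e j → i ≡ j
  join-injective {i} {j} eq = trans (sym (splitAt-join d e i))
                                (trans (cong (splitAt d) eq) (splitAt-join d e j))
  h : Fin _ → Fin d ⊎ Fin e
  h j with any? (λ i → R? N (repr N j) (a i))
  ... | yes (i , _) = inj₁ i
  ... | no uncovered = inj₂ (label (repr N j) (λ i r → uncovered (i , r)))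
  reprs-related : ∀ {i j} → R (repr N i) (repr N j) → i ≡ j
  reprs-related {i} {j} r =
    trans (sym (classOf-repr N i)) (trans (R⇒sameClass N r) (classOf-repr N j))
  h-injective : ∀ {i j} → h i ≡ h j → i ≡ j
  h-injective {i} {j} eq with any? (λ l → R? N (repr N i) (a l))
                          | any? (λ l → R? N (repr N j) (a l))
  ... | yes (l , ri) | yes (l′ , rj) with inj₁-injective eq
  ...   | refl = reprs-related (∼-trans ri (∼-sym rj))
  h-injective () | yes _ | no _
  h-injective () | no _ | yes _
  h-injective eq | no _ | no _ = reprs-related (label-reflects _ _ (inj₂-injective eq))

¬¬-numClasses : {R : Rel (Fin k) 0ℓ} → IsEquivalence R → DoubleNegation (∃ (NumClasses R))
¬¬-numClasses {zero} _ = pure (0 , (λ ()) , (λ ()) , (λ ()))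
¬¬-numClasses {suc k} {R} isEq = do
  (c , N) ← ¬¬-numClasses {R = R₊} (record { refl = ∼-refl ; sym = ∼-sym ; trans = ∼-trans })
  zero-joins? ← ¬¬-excluded-middle {A = ∃ λ x → R zero (suc x)}
  pure (addZero N zero-joins?)
  where
  open IsEquivalence isEq using () renaming (refl to ∼-refl; sym to ∼-sym; trans to ∼-trans)
  R₊ : Rel (Fin k) 0ℓ
  R₊ x y = R (suc x) (suc y)
  addZero : ∀ {c} → NumClasses R₊ c → Dec (∃ λ x → R zero (suc x)) → ∃ (NumClasses R)
  addZero {c} N (yes (x₀ , r₀)) = c , f , (λ j → suc (repr N j) , classOf-repr N j) , kernel
    where
    f : Fin (suc k) → Fin c
    f zero = classOf N x₀
    f (suc y) = classOf N y
    kernel : ∀ x y → (f x ≡ f y → R x y) × (R x y → f x ≡ f y)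
    kernel zero zero = (λ _ → ∼-refl) , (λ _ → refl)
    kernel zero (suc y) = (λ eq → ∼-trans r₀ (sameClass⇒R N eq))
                        , (λ r → R⇒sameClass N (∼-trans (∼-sym r₀) r))
    kernel (suc x) zero = (λ eq → ∼-trans (sameClass⇒R N eq) (∼-sym r₀))
                        , (λ r → R⇒sameClass N (∼-trans r r₀))
    kernel (suc x) (suc y) = sameClass⇒R N , R⇒sameClass N
  addZero {c} N (no apart) = suc c , f , surjective , kernel
    where
    f : Fin (suc k) → Fin (suc c)
    f zero = zero
    f (suc y) = suc (classOf N y)
    surjective : ∀ j → ∃ λ x → f x ≡ j
    surjective zero = zero , refl
    surjective (suc j) = suc (repr N j) , cong suc (classOf-repr N j)
    kernel : ∀ x y → (f x ≡ f y → R x y) × (R x y → f x ≡ f y)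
    kernel zero zero = (λ _ → ∼-refl) , (λ _ → refl)
    kernel zero (suc y) = (λ ()) , (λ r → contradiction (y , r) apart)
    kernel (suc x) zero = (λ ()) , (λ r → contradiction (x , ∼-sym r) apart)
    kernel (suc x) (suc y) = sameClass⇒R N ∘ suc-injective , cong suc ∘ R⇒sameClass N

classes-antimono : {R S : Rel (Fin k) 0ℓ} → IsEquivalence S → R ⇒ S →
                   NumClasses R c → NumClasses S d → d ≤ c
classes-antimono isEqS R⊆S NR = classes-≤ isEqS (λ ()) (λ y _ → classOf NR y)
                                   (λ _ _ → R⊆S ∘ sameClass⇒R NR)

-- For an equivalence S, the equivalence generated by S and the pair p ~ q.
Merge : Rel (Fin k) 0ℓ → Fin k → Fin k → Rel (Fin k) 0ℓ
Merge S p q x y = S x y ⊎ (S x p × S q y) ⊎ (S x q × S p y)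

module _ {S : Rel (Fin k) 0ℓ} (isEq : IsEquivalence S) {p q : Fin k} where
  open IsEquivalence isEq using () renaming (refl to ∼-refl; sym to ∼-sym; trans to ∼-trans)

  Merge-isEquivalence : IsEquivalence (Merge S p q)
  Merge-isEquivalence = record { refl = inj₁ ∼-refl ; sym = merge-sym ; trans = merge-trans }
    where
    merge-sym : ∀ {x y} → Merge S p q x y → Merge S p q y x
    merge-sym (inj₁ s) = inj₁ (∼-sym s)
    merge-sym (inj₂ (inj₁ (xp , qy))) = inj₂ (inj₂ (∼-sym qy , ∼-sym xp))
    merge-sym (inj₂ (inj₂ (xq , py))) = inj₂ (inj₁ (∼-sym py , ∼-sym xq))
    merge-trans : ∀ {x y z} → Merge S p q x y → Merge S p q y z → Merge S p q x z
    merge-trans (inj₁ s) (inj₁ t) = inj₁ (∼-trans s t)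
    merge-trans (inj₁ s) (inj₂ (inj₁ (yp , qz))) = inj₂ (inj₁ (∼-trans s yp , qz))
    merge-trans (inj₁ s) (inj₂ (inj₂ (yq , pz))) = inj₂ (inj₂ (∼-trans s yq , pz))
    merge-trans (inj₂ (inj₁ (xp , qy))) (inj₁ t) = inj₂ (inj₁ (xp , ∼-trans qy t))
    merge-trans (inj₂ (inj₁ (xp , _))) (inj₂ (inj₁ (_ , qz))) = inj₂ (inj₁ (xp , qz))
    merge-trans (inj₂ (inj₁ (xp , _))) (inj₂ (inj₂ (_ , pz))) = inj₁ (∼-trans xp pz)
    merge-trans (inj₂ (inj₂ (xq , py))) (inj₁ t) = inj₂ (inj₂ (xq , ∼-trans py t))
    merge-trans (inj₂ (inj₂ (xq , _))) (inj₂ (inj₁ (_ , qz))) = inj₁ (∼-trans xq qz)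
    merge-trans (inj₂ (inj₂ (xq , _))) (inj₂ (inj₂ (_ , pz))) = inj₂ (inj₂ (xq , pz))

  Merge-collapse : S p q → Merge S p q ⇒ S
  Merge-collapse pq (inj₁ s) = s
  Merge-collapse pq (inj₂ (inj₁ (xp , qy))) = ∼-trans xp (∼-trans pq qy)
  Merge-collapse pq (inj₂ (inj₂ (xq , py))) = ∼-trans xq (∼-trans (∼-sym pq) py)

  Merge-away : ∀ {x y} → ¬ S x p → ¬ S y p → Merge S p q x y → S x y
  Merge-away _ _ (inj₁ s) = s
  Merge-away ¬xp _ (inj₂ (inj₁ (xp , _))) = contradiction xp ¬xp
  Merge-away _ ¬yp (inj₂ (inj₂ (_ , py))) = contradiction (∼-sym py) ¬yp

  classes-merge : {R : Rel (Fin k) 0ℓ} → R ⇒ Merge S p q →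
                  NumClasses R c → NumClasses S d → d ≤ suc c
  classes-merge R⊆merge NR = classes-≤ isEq (λ _ → p) (λ y _ → classOf NR y)
    (λ ny ny′ → Merge-away (ny zero) (ny′ zero) ∘ R⊆merge ∘ sameClass⇒R NR)

classes-split : {R R′ : Rel (Fin k) 0ℓ} → IsEquivalence R → Symmetric R′ → R′ ⇒ R →
                ∀ {p p′} → R p p′ → ¬ R′ p p′ →
                NumClasses R c → NumClasses R′ d → suc c ≤ d
classes-split {k = k} {c = c} {R′ = R′} isEq R′-sym R′⊆R {p} {p′} pp′ ¬pp′ NR =
  classes-≥ point separated
  where
  open IsEquivalence isEq using () renaming (sym to ∼-sym; trans to ∼-trans)
  point : Fin (suc c) → Fin k
  point zero = p′
  point (suc i) with i ≟ classOf NR p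
  ... | yes _ = p
  ... | no _ = repr NR i
  point-in-class : ∀ i → classOf NR (point (suc i)) ≡ i
  point-in-class i with i ≟ classOf NR p
  ... | yes i≡p = sym i≡p
  ... | no _ = classOf-repr NR i
  p′-apart : ∀ i → ¬ R′ p′ (point (suc i))
  p′-apart i with i ≟ classOf NR p
  ... | yes _ = ¬pp′ ∘ R′-sym
  ... | no i≢p = λ r → i≢p (trans (sym (classOf-repr NR i))
                                     (R⇒sameClass NR (∼-sym (∼-trans pp′ (R′⊆R r)))))
  separated : ∀ {i j} → R′ (point i) (point j) → i ≡ j
  separated {zero} {zero} _ = refl
  separated {zero} {suc j} r = contradiction r (p′-apart j)
  separated {suc i} {zero} r = contradiction (R′-sym r) (p′-apart i)
  separated {suc i} {suc j} r = cong suc (trans (sym (point-in-class i))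
                                   (trans (R⇒sameClass NR (R′⊆R r)) (point-in-class j)))

module _ {K : Fin k → Set} {ι : Fin k′ → Fin k} (ι-avoids : ∀ x → ¬ K (ι x))
         {R : Rel (Fin k) 0ℓ} (isEq : IsEquivalence R) {R′ : Rel (Fin k′) 0ℓ} where
  open IsEquivalence isEq using () renaming (sym to ∼-sym)

  classes-restrict-drop : (∀ {x y} → R (ι x) (ι y) → R′ x y) →
                          (a : Fin k) → (∀ {y} → R a y → K y) →
                          NumClasses R c → NumClasses R′ d → suc d ≤ c
  classes-restrict-drop {d = d} reflects a class-of-a⊆K NR NR′ = classes-≥ point separated NR
    where
    point : Fin (suc d) → Fin k
    point zero = a
    point (suc j) = ι (repr NR′ j)
    separated : ∀ {i j} → R (point i) (point j) → i ≡ j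
    separated {zero} {zero} _ = refl
    separated {zero} {suc j} r = contradiction (class-of-a⊆K r) (ι-avoids _)
    separated {suc i} {zero} r = contradiction (class-of-a⊆K (∼-sym r)) (ι-avoids _)
    separated {suc i} {suc j} r =
      cong suc (trans (sym (classOf-repr NR′ i)) (trans (R⇒sameClass NR′ (reflects r)) (classOf-repr NR′ j)))

  classes-restrict : (∀ y → ¬ K y → ∃ λ x → ι x ≡ y) → (∀ {x y} → R′ x y → R (ι x) (ι y)) →
                     (a : Fin d → Fin k) → (∀ y → K y → ∃ λ i → R y (a i)) →
                     NumClasses R c → NumClasses R′ e → c ≤ d + e
  classes-restrict ι-onto preserves a K-covered NR NR′ = classes-≤ isEq a label label-reflects NR
    where
    preimage : ∀ y → (∀ i → ¬ R y (a i)) → ∃ λ x → ι x ≡ y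
    preimage y uncovered = ι-onto y (λ ky → let (i , r) = K-covered y ky in uncovered i r)
    label : ∀ y → (∀ i → ¬ R y (a i)) → Fin _
    label y uncovered = classOf NR′ (proj₁ (preimage y uncovered))
    label-reflects : ∀ {y y′} ny ny′ → label y ny ≡ label y′ ny′ → R y y′
    label-reflects {y} {y′} ny ny′ eq with preimage y ny | preimage y′ ny′
    ... | x , refl | x′ , refl = preserves (sameClass⇒R NR′ eq)

-- Orbits

module _ {A : Rel (Fin k) 0ℓ} (isEq : IsEquivalence A) where
  open IsEquivalence isEq using () renaming (refl to ∼-refl; trans to ∼-trans)

  star-least : {T : Rel (Fin k) 0ℓ} → T ⇒ A → Star T ⇒ A
  star-least T⊆A = fold A (λ t a → ∼-trans (T⊆A t) a) ∼-refl

  orbit₂-least : ∀ {f g} → (∀ z → A z (f z)) → (∀ z → A z (g z)) → Star (Step₂ f g) ⇒ A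
  orbit₂-least f⊆A g⊆A = star-least λ { (inj₁ refl) → f⊆A _ ; (inj₂ refl) → g⊆A _ }

  orbit₃-least : ∀ {f g h} → (∀ z → A z (f z)) → (∀ z → A z (g z)) → (∀ z → A z (h z)) →
                 Star (Step₃ f g h) ⇒ A
  orbit₃-least f⊆A g⊆A h⊆A =
    star-least λ { (inj₁ refl) → f⊆A _ ; (inj₂ (inj₁ refl)) → g⊆A _ ; (inj₂ (inj₂ refl)) → h⊆A _ }

module _ {f g : Fin k → Fin k} (z : Fin k) where

  orbit₂-f : Star (Step₂ f g) z (f z)
  orbit₂-f = inj₁ refl ◅ ε

  orbit₂-g : Star (Step₂ f g) z (g z)
  orbit₂-g = inj₂ refl ◅ ε

module _ {f g h : Fin k → Fin k} (z : Fin k) where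

  orbit₃-f : Star (Step₃ f g h) z (f z)
  orbit₃-f = inj₁ refl ◅ ε

  orbit₃-g : Star (Step₃ f g h) z (g z)
  orbit₃-g = inj₂ (inj₁ refl) ◅ ε

  orbit₃-h : Star (Step₃ f g h) z (h z)
  orbit₃-h = inj₂ (inj₂ refl) ◅ ε

star-closed : {T : Rel (Fin k) 0ℓ} (K : Fin k → Set) → (∀ {x y} → T x y → K x → K y) →
              ∀ {x y} → Star T x y → K x → K y
star-closed K closed = fold (λ x y → K x → K y) (λ t Ky⇒Kz → Ky⇒Kz ∘ closed t) id

module _ {f g : Fin k → Fin k} (f-inv : ∀ x → f (f x) ≡ x) (g-inv : ∀ x → g (g x) ≡ x) where

  orbit₂-isEquivalence : IsEquivalence (Star (Step₂ f g))
  orbit₂-isEquivalence = record { refl = ε ; sym = reverse step-sym ; trans = _◅◅_ }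
    where
    step-sym : ∀ {x y} → Step₂ f g x y → Step₂ f g y x
    step-sym (inj₁ refl) = inj₁ (f-inv _)
    step-sym (inj₂ refl) = inj₂ (g-inv _)

  orbit₃-isEquivalence : ∀ {h} → (∀ x → h (h x) ≡ x) → IsEquivalence (Star (Step₃ f g h))
  orbit₃-isEquivalence {h} h-inv = record { refl = ε ; sym = reverse step-sym ; trans = _◅◅_ }
    where
    step-sym : ∀ {x y} → Step₃ f g h x y → Step₃ f g h y x
    step-sym (inj₁ refl) = inj₁ (f-inv _)
    step-sym (inj₂ (inj₁ refl)) = inj₂ (inj₁ (g-inv _))
    step-sym (inj₂ (inj₂ refl)) = inj₂ (inj₂ (h-inv _))

module _ (M : Map) where

  VertexOrb-isEquivalence : IsEquivalence (VertexOrb M)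
  VertexOrb-isEquivalence = orbit₂-isEquivalence (inv1 M) (inv2 M)

  EdgeOrb-isEquivalence : IsEquivalence (EdgeOrb M)
  EdgeOrb-isEquivalence = orbit₂-isEquivalence (inv0 M) (inv2 M)

  FaceOrb-isEquivalence : IsEquivalence (FaceOrb M)
  FaceOrb-isEquivalence = orbit₂-isEquivalence (inv0 M) (inv1 M)

  CompOrb-isEquivalence : IsEquivalence (CompOrb M)
  CompOrb-isEquivalence = orbit₃-isEquivalence (inv0 M) (inv1 M) (inv2 M)

  t1-flip : ∀ {x y} → t1 M x ≡ y → x ≡ t1 M y
  t1-flip {x} eq = trans (sym (inv1 M x)) (cong (t1 M) eq)

  t1-injective : ∀ {x y} → t1 M x ≡ t1 M y → x ≡ y
  t1-injective {x} {y} eq = trans (sym (inv1 M x)) (trans (cong (t1 M) eq) (inv1 M y))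

FaceOrb⇒CompOrb : (M : Map) → FaceOrb M ⇒ CompOrb M
FaceOrb⇒CompOrb M = orbit₂-least (CompOrb-isEquivalence M) orbit₃-f orbit₃-g

module Realization {M : Map} {G : Graph} {vtx : Fin (m M) → Fin (n G)} (realizes : Realizes M G vtx) where

  same-vertex⇔ : ∀ x y → (vtx x ≡ vtx y → VertexOrb M x y) × (VertexOrb M x y → vtx x ≡ vtx y)
  same-vertex⇔ = proj₁ realizes

  flag-adjacent : ∀ x → adj G (vtx x) (vtx (t0 M x)) ≡ true
  flag-adjacent = proj₁ (proj₂ realizes)

  edge-has-flag : ∀ u w → adj G u w ≡ true → ∃ λ x → (vtx x ≡ u) × (vtx (t0 M x) ≡ w)
  edge-has-flag = proj₁ (proj₂ (proj₂ realizes))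

  flags-share-edge : ∀ x y → vtx x ≡ vtx y → vtx (t0 M x) ≡ vtx (t0 M y) → EdgeOrb M x y
  flags-share-edge = proj₂ (proj₂ (proj₂ realizes))

module _ {ι : Fin k′ → Fin k} where

  step₂-map : ∀ {f g f′ g′} → (∀ x → ι (f′ x) ≡ f (ι x)) → (∀ x → ι (g′ x) ≡ g (ι x)) →
              ∀ {x y} → Star (Step₂ f′ g′) x y → Star (Step₂ f g) (ι x) (ι y)
  step₂-map f-comm g-comm =
    gmap ι λ { (inj₁ refl) → inj₁ (sym (f-comm _)) ; (inj₂ refl) → inj₂ (sym (g-comm _)) }

  star-reflect : (∀ {x y} → ι x ≡ ι y → x ≡ y) → {T : Rel (Fin k) 0ℓ} {T′ : Rel (Fin k′) 0ℓ} →
                 (∀ {x z} → T (ι x) z → ∃ λ y → ι y ≡ z × T′ x y) →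
                 ∀ {x y} → Star T (ι x) (ι y) → Star T′ x y
  star-reflect ι-injective {T} {T′} lift-step path = go path refl refl
    where
    go : ∀ {u w x y} → Star T u w → ι x ≡ u → ι y ≡ w → Star T′ x y
    go ε refl eq = subst (Star T′ _) (ι-injective (sym eq)) ε
    go (t ◅ ts) refl eq with lift-step t
    ... | x′ , refl , t′ = t′ ◅ go ts refl eq

  step₂-reflect : (∀ {x y} → ι x ≡ ι y → x ≡ y) → ∀ {f g f′ g′} →
                  (∀ x → ι (f′ x) ≡ f (ι x)) → (∀ x → ι (g′ x) ≡ g (ι x)) →
                  ∀ {x y} → Star (Step₂ f g) (ι x) (ι y) → Star (Step₂ f′ g′) x y
  step₂-reflect ι-injective f-comm g-comm = star-reflect ι-injective λ
    { (inj₁ refl) → _ , f-comm _ , inj₁ refl ; (inj₂ refl) → _ , g-comm _ , inj₂ refl }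

  step₃-reflect : (∀ {x y} → ι x ≡ ι y → x ≡ y) → ∀ {f g h f′ g′ h′} →
                  (∀ x → ι (f′ x) ≡ f (ι x)) → (∀ x → ι (g′ x) ≡ g (ι x)) →
                  (∀ x → ι (h′ x) ≡ h (ι x)) →
                  ∀ {x y} → Star (Step₃ f g h) (ι x) (ι y) → Star (Step₃ f′ g′ h′) x y
  step₃-reflect ι-injective f-comm g-comm h-comm = star-reflect ι-injective λ
    { (inj₁ refl) → _ , f-comm _ , inj₁ refl
    ; (inj₂ (inj₁ refl)) → _ , g-comm _ , inj₂ (inj₁ refl)
    ; (inj₂ (inj₂ refl)) → _ , h-comm _ , inj₂ (inj₂ refl) }

-- Finite sums and parity

does≡true⇒ : {A : Set} (a? : Dec A) → does a? ≡ true → A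
does≡true⇒ (yes a) _ = a

does≡false⇒ : {A : Set} (a? : Dec A) → does a? ≡ false → ¬ A
does≡false⇒ (no ¬a) _ = ¬a

∧-not⇒ : ∀ {a b} → a ∧ not b ≡ true → a ≡ true × b ≡ false
∧-not⇒ {true} {false} _ = refl , refl

𝟙 : Bool → ℕ
𝟙 b = if b then 1 else 0

∑-zero : (f : Fin k → ℕ) → (∀ x → f x ≡ 0) → ∑ f ≡ 0
∑-zero {k} f f≡0 = trans (sum-cong-≗ f≡0) (sum-replicate-zero k)

∑-mono-≤ : {f g : Fin k → ℕ} → (∀ x → f x ≤ g x) → ∑ f ≤ ∑ g
∑-mono-≤ {zero} _ = z≤n
∑-mono-≤ {suc k} f≤g = +-mono-≤ (f≤g zero) (∑-mono-≤ (f≤g ∘ suc))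

∑-mono-< : {f g : Fin k → ℕ} → (∀ x → f x ≤ g x) → ∀ z → f z < g z → ∑ f < ∑ g
∑-mono-< {suc k} f≤g zero fz<gz = +-mono-<-≤ fz<gz (∑-mono-≤ (f≤g ∘ suc))
∑-mono-< {suc k} f≤g (suc z) fz<gz = +-mono-≤-< (f≤g zero) (∑-mono-< (f≤g ∘ suc) z fz<gz)

sum-allFin : (f : Fin k → ℕ) → sum (List.map f (allFin k)) ≡ ∑ f
sum-allFin f = trans (cong sum (map-tabulate id f)) (sum-tabulate f)
  where
  sum-tabulate : ∀ {k} (f : Fin k → ℕ) → sum (List.tabulate f) ≡ ∑ f
  sum-tabulate {zero} f = refl
  sum-tabulate {suc k} f = cong (f zero +_) (sum-tabulate (f ∘ suc))

count : (Fin k → Bool) → ℕ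
count T = ∑ (𝟙 ∘ T)

_─_ : (Fin k → Bool) → Fin k → Fin k → Bool
(T ─ z) x = T x ∧ not (does (x ≟ z))

module _ (T : Fin k → Bool) (z : Fin k) where

  ─-self : (T ─ z) z ≡ false
  ─-self rewrite dec-true (z ≟ z) refl = ∧-zeroʳ (T z)

  ─-other : ∀ {x} → x ≢ z → (T ─ z) x ≡ T x
  ─-other {x} x≢z rewrite dec-false (x ≟ z) x≢z = ∧-identityʳ (T x)

  ─-sound : ∀ {x} → (T ─ z) x ≡ true → T x ≡ true × x ≢ z
  ─-sound {x} T─z∋x with x ≟ z
  ... | yes refl = contradiction (trans (sym (∧-zeroʳ (T x))) T─z∋x) λ ()
  ... | no x≢z = trans (sym (∧-identityʳ (T x))) T─z∋x , x≢z

  ─-complete : ∀ {x} → T x ≡ true → x ≢ z → (T ─ z) x ≡ true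
  ─-complete Tx x≢z = trans (─-other x≢z) Tx

count-─ : (T : Fin k → Bool) (z : Fin k) → T z ≡ true → count T ≡ suc (count (T ─ z))
count-─ {suc k} T z Tz = begin
  count T                             ≡⟨ sum-remove (𝟙 ∘ T) ⟩
  𝟙 (T z) + rest T                    ≡⟨ cong (λ b → 𝟙 b + rest T) Tz ⟩
  suc (rest T)                        ≡⟨ cong suc (sum-cong-≗ (cong 𝟙 ∘ sym ∘ ─-other T z ∘ punchIn≢z)) ⟩
  suc (rest (T ─ z))                  ≡⟨ cong (λ b → suc (𝟙 b + rest (T ─ z))) (sym (─-self T z)) ⟩
  suc (𝟙 ((T ─ z) z) + rest (T ─ z))  ≡⟨ cong suc (sym (sum-remove (𝟙 ∘ (T ─ z)))) ⟩
  suc (count (T ─ z))                 ∎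
  where
  open ≡-Reasoning
  rest : (Fin (suc k) → Bool) → ℕ
  rest S = ∑ (𝟙 ∘ S ∘ punchIn z)
  punchIn≢z : ∀ y → punchIn z y ≢ z
  punchIn≢z = punchInᵢ≢i z

count-nonzero : (T : Fin k → Bool) → ∀ {N} → count T ≡ suc N → ∃ λ x → T x ≡ true
count-nonzero T count≡suc with any? (λ x → T x Bool.≟ true)
... | yes found = found
... | no none = contradiction (trans (sym count≡suc) (∑-zero (𝟙 ∘ T) all-zero)) λ ()
  where
  all-zero : ∀ x → 𝟙 (T x) ≡ 0
  all-zero x with T x in Tx
  ... | true = contradiction (x , Tx) none
  ... | false = refl

-- A set closed under a fixed-point-free involution splits into pairs {x, σ x}.
count-even : {σ : Fin k → Fin k} → (∀ x → σ (σ x) ≡ x) → (∀ x → σ x ≢ x) →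
             (T : Fin k → Bool) → (∀ x → T x ≡ true → T (σ x) ≡ true) → 2 ∣ count T
count-even {k = k} {σ = σ} σ-inv σ-fpf T closed = go _ T closed refl
  where
  Closed : (Fin k → Bool) → Set
  Closed T = ∀ x → T x ≡ true → T (σ x) ≡ true
  go : ∀ N T → Closed T → count T ≡ N → 2 ∣ N
  go zero _ _ _ = 2 ∣0
  go (suc N) T closed count≡ with count-nonzero T count≡
  ... | x , Tx = pairs (ℕ.suc-injective (trans (sym count≡) count-pair))
    where
    T₁ : Fin k → Bool
    T₁ = T ─ x
    T₁∋σx : T₁ (σ x) ≡ true
    T₁∋σx = ─-complete T x (closed x Tx) (σ-fpf x)
    T₂ : Fin k → Bool
    T₂ = T₁ ─ σ x
    count-pair : count T ≡ suc (suc (count T₂))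
    count-pair = trans (count-─ T x Tx) (cong suc (count-─ T₁ (σ x) T₁∋σx))
    closed₂ : Closed T₂
    closed₂ y T₂∋y =
      let (T₁∋y , y≢σx) = ─-sound T₁ (σ x) T₂∋y
          (T∋y , y≢x) = ─-sound T x T₁∋y
      in ─-complete T₁ (σ x) (─-complete T x (closed y T∋y) (y≢σx ∘ σ-flip))
                             (y≢x ∘ σ-injective)
      where
      σ-flip : ∀ {u w} → σ u ≡ w → u ≡ σ w
      σ-flip {u} eq = trans (sym (σ-inv u)) (cong σ eq)
      σ-injective : ∀ {u w} → σ u ≡ σ w → u ≡ w
      σ-injective {w = w} eq = trans (σ-flip eq) (σ-inv w)
    pairs : ∀ {N} → N ≡ suc (count T₂) → 2 ∣ suc N
    pairs {suc N′} eq = ∣m∣n⇒∣m+n {m = 2} ∣-refl (go N′ T₂ closed₂ (sym (ℕ.suc-injective eq)))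

even⇒¬odd : ∀ {N} → 2 ∣ N → ¬ 2 ∣ suc N
even⇒¬odd {N} 2∣N 2∣1+N =
  contradiction (∣1⇒≡1 (∣m+n∣m⇒∣n (subst (2 ∣_) (+-comm 1 N) 2∣1+N) 2∣N)) λ ()

-- Euler genus

record CellCounts (M : Map) : Set where
  field
    V E F K : ℕ
    vertices : NumClasses (VertexOrb M) V
    edges : NumClasses (EdgeOrb M) E
    faces : NumClasses (FaceOrb M) F
    components : NumClasses (CompOrb M) K

¬¬-cellCounts : (M : Map) → DoubleNegation (CellCounts M)
¬¬-cellCounts M = do
  (V , NV) ← ¬¬-numClasses (VertexOrb-isEquivalence M)
  (E , NE) ← ¬¬-numClasses (EdgeOrb-isEquivalence M)
  (F , NF) ← ¬¬-numClasses (FaceOrb-isEquivalence M)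
  (K , NK) ← ¬¬-numClasses (CompOrb-isEquivalence M)
  pure (record { vertices = NV ; edges = NE ; faces = NF ; components = NK })

-- M′ ≼ M: the Euler genus 2K − V + E − F of M′ is at most that of M (rearranged to avoid
-- truncated subtraction).
_≼_ : Map → Map → Set
M′ ≼ M = (C′ : CellCounts M′) (C : CellCounts M) →
         2 * K C′ + E C′ + (V C + F C) ≤ 2 * K C + E C + (V C′ + F C′)
  where open CellCounts

module _ {K′ E′ V′ F′ K E V F : ℕ} where
  open ≤-Reasoning

  genus-≤-mono : K′ ≤ K → E′ ≤ E → V ≤ V′ → F ≤ F′ →
                 2 * K′ + E′ + (V + F) ≤ 2 * K + E + (V′ + F′)
  genus-≤-mono K′≤K E′≤E V≤V′ F≤F′ =
    +-mono-≤ (+-mono-≤ (*-monoʳ-≤ 2 K′≤K) E′≤E) (+-mono-≤ V≤V′ F≤F′)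

  genus-≤-vertex-for-face : K′ ≤ K → E′ ≤ E → suc V ≤ V′ → F ≤ suc F′ →
                            2 * K′ + E′ + (V + F) ≤ 2 * K + E + (V′ + F′)
  genus-≤-vertex-for-face K′≤K E′≤E V<V′ F≤1+F′ =
    +-mono-≤ (+-mono-≤ (*-monoʳ-≤ 2 K′≤K) E′≤E) (begin
    V + F        ≤⟨ +-monoʳ-≤ V F≤1+F′ ⟩
    V + suc F′   ≡⟨ +-suc V F′ ⟩
    suc V + F′   ≤⟨ +-monoˡ-≤ F′ V<V′ ⟩
    V′ + F′      ∎)

  genus-≤-vertex-face-for-component : K′ ≤ suc K → E′ ≤ E → suc V ≤ V′ → suc F ≤ F′ →
                                      2 * K′ + E′ + (V + F) ≤ 2 * K + E + (V′ + F′)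
  genus-≤-vertex-face-for-component K′≤1+K E′≤E V<V′ F<F′ = begin
    2 * K′ + E′ + (V + F)
      ≤⟨ +-monoˡ-≤ (V + F) (+-mono-≤ (*-monoʳ-≤ 2 K′≤1+K) E′≤E) ⟩
    2 * suc K + E + (V + F)
      ≡⟨ solve 4 (λ K E V F → con 2 :* (con 1 :+ K) :+ E :+ (V :+ F)
                            := con 2 :* K :+ E :+ ((con 1 :+ V) :+ (con 1 :+ F))) refl K E V F ⟩
    2 * K + E + (suc V + suc F)
      ≤⟨ +-monoʳ-≤ (2 * K + E) (+-mono-≤ V<V′ F<F′) ⟩
    2 * K + E + (V′ + F′)
      ∎

  genus-≤-drop-edge-component : suc K′ ≤ K → suc E′ ≤ E → V ≤ 2 + V′ → F ≤ 1 + F′ →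
                                2 * K′ + E′ + (V + F) ≤ 2 * K + E + (V′ + F′)
  genus-≤-drop-edge-component K′<K E′<E V≤2+V′ F≤1+F′ = begin
    2 * K′ + E′ + (V + F)
      ≤⟨ +-monoʳ-≤ (2 * K′ + E′) (+-mono-≤ V≤2+V′ F≤1+F′) ⟩
    2 * K′ + E′ + (2 + V′ + (1 + F′))
      ≡⟨ solve 4 (λ K E V F → con 2 :* K :+ E :+ (con 2 :+ V :+ (con 1 :+ F))
                            := con 2 :* (con 1 :+ K) :+ (con 1 :+ E) :+ (V :+ F)) refl K′ E′ V′ F′ ⟩
    2 * suc K′ + suc E′ + (V′ + F′)
      ≤⟨ +-monoˡ-≤ (V′ + F′) (+-mono-≤ (*-monoʳ-≤ 2 K′<K) E′<E) ⟩
    2 * K + E + (V′ + F′)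
      ∎

-- EulerGenusAtMost 1 unfolds to EulerGenusAtMost1 of Defs.
EulerGenusAtMost : ℕ → Map → Set
EulerGenusAtMost g M =
  Σ ℕ λ V → Σ ℕ λ E → Σ ℕ λ F → Σ ℕ λ K →
    NumClasses (VertexOrb M) V × NumClasses (EdgeOrb M) E
    × NumClasses (FaceOrb M) F × NumClasses (CompOrb M) K
    × (2 * K + E ≤ g + V + F)

genus-≼ : ∀ {g M M′} → M′ ≼ M → EulerGenusAtMost g M → DoubleNegation (EulerGenusAtMost g M′)
genus-≼ {g} {M} {M′} M′≼M (V , E , F , K , NV , NE , NF , NK , bound) = do
  C′ ← ¬¬-cellCounts M′
  let open CellCounts C′ renaming (V to V′; E to E′; F to F′; K to K′)
  pure (V′ , E′ , F′ , K′ , vertices , edges , faces , components ,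
        +-cancelʳ-≤ (V + F) _ _ (begin
          2 * K′ + E′ + (V + F)     ≤⟨ M′≼M C′ C ⟩
          2 * K + E + (V′ + F′)     ≤⟨ +-monoˡ-≤ (V′ + F′) bound ⟩
          g + V + F + (V′ + F′)     ≡⟨ solve 5 (λ g V F V′ F′ → g :+ V :+ F :+ (V′ :+ F′)
                                                              := g :+ V′ :+ F′ :+ (V :+ F)) refl g V F V′ F′ ⟩
          g + V′ + F′ + (V + F)     ∎))
  where
  open ≤-Reasoning
  C : CellCounts M
  C = record { vertices = NV ; edges = NE ; faces = NF ; components = NK }

-- Map surgery

-- Detaching the half-edge of flag p from its vertex: the new t1 pairs p with t2 p and
-- closes up the rotation where the half-edge was.
module Detach (M : Map) (p : Fin (m M)) where

  q : Fin (m M)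
  q = t2 M p

  InHalfEdge : Fin (m M) → Set
  InHalfEdge y = y ≡ p ⊎ y ≡ q

  inHalfEdge? : ∀ y → Dec (InHalfEdge y)
  inHalfEdge? y = (y ≟ p) ⊎-dec (y ≟ q)

  InHalfEdge-t2 : ∀ {y} → InHalfEdge y → InHalfEdge (t2 M y)
  InHalfEdge-t2 (inj₁ refl) = inj₂ refl
  InHalfEdge-t2 (inj₂ refl) = inj₁ (inv2 M p)

  private
    t1′-by : ∀ y → Dec (InHalfEdge y) → Dec (InHalfEdge (t1 M y)) → Fin (m M)
    t1′-by y (yes _) _ = t2 M y
    t1′-by y (no _) (yes _) = t1 M (t2 M (t1 M y))
    t1′-by y (no _) (no _) = t1 M y

  t1′ : Fin (m M) → Fin (m M)
  t1′ y = t1′-by y (inHalfEdge? y) (inHalfEdge? (t1 M y))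

  data T1′View (y z : Fin (m M)) : Set where
    in-half-edge : InHalfEdge y → z ≡ t2 M y → T1′View y z
    next-to-half-edge : ¬ InHalfEdge y → InHalfEdge (t1 M y) → z ≡ t1 M (t2 M (t1 M y)) → T1′View y z
    away : ¬ InHalfEdge y → ¬ InHalfEdge (t1 M y) → z ≡ t1 M y → T1′View y z

  t1′-view : ∀ y → T1′View y (t1′ y)
  t1′-view y = view-by (inHalfEdge? y) (inHalfEdge? (t1 M y))
    where
    view-by : ∀ d d₁ → T1′View y (t1′-by y d d₁)
    view-by (yes at) _ = in-half-edge at refl
    view-by (no ¬at) (yes at₁) = next-to-half-edge ¬at at₁ refl
    view-by (no ¬at) (no ¬at₁) = away ¬at ¬at₁ refl

  t1′-at : ∀ {y} → InHalfEdge y → t1′ y ≡ t2 M y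
  t1′-at {y} at with t1′-view y
  ... | in-half-edge _ eq = eq
  ... | next-to-half-edge ¬at _ _ = contradiction at ¬at
  ... | away ¬at _ _ = contradiction at ¬at

  t1′-away : ∀ {y} → ¬ InHalfEdge y → ¬ InHalfEdge (t1 M y) → t1′ y ≡ t1 M y
  t1′-away {y} ¬at ¬at₁ with t1′-view y
  ... | in-half-edge at _ = contradiction at ¬at
  ... | next-to-half-edge _ at₁ _ = contradiction at₁ ¬at₁
  ... | away _ _ eq = eq

  t1′-next : ∀ {y} → ¬ InHalfEdge y → InHalfEdge (t1 M y) → t1′ y ≡ t1 M (t2 M (t1 M y))
  t1′-next {y} ¬at at₁ with t1′-view y
  ... | in-half-edge at _ = contradiction at ¬at
  ... | next-to-half-edge _ _ eq = eq
  ... | away _ ¬at₁ _ = contradiction at₁ ¬at₁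

  InHalfEdge-pair : ∀ {w z} → InHalfEdge w → InHalfEdge z → z ≡ w ⊎ z ≡ t2 M w
  InHalfEdge-pair (inj₁ refl) (inj₁ refl) = inj₁ refl
  InHalfEdge-pair (inj₁ refl) (inj₂ refl) = inj₂ refl
  InHalfEdge-pair (inj₂ refl) (inj₁ refl) = inj₂ (sym (inv2 M p))
  InHalfEdge-pair (inj₂ refl) (inj₂ refl) = inj₁ refl

  t1′-inv : ∀ y → t1′ (t1′ y) ≡ y
  t1′-inv y with t1′-view y
  ... | in-half-edge at eq = trans (cong t1′ eq) (trans (t1′-at (InHalfEdge-t2 at)) (inv2 M y))
  ... | next-to-half-edge ¬at at₁ eq =
    trans (cong t1′ eq) (trans (t1′-next ¬at-z (subst InHalfEdge (sym (inv1 M w)) at-w)) back)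
    where
    -- t1′ y = t1 w is again next to the half-edge, and t1′ retraces the path through w.
    w : Fin (m M)
    w = t2 M (t1 M y)
    at-w : InHalfEdge w
    at-w = InHalfEdge-t2 at₁
    ¬at-z : ¬ InHalfEdge (t1 M w)
    ¬at-z at-z with InHalfEdge-pair at-w at-z
    ... | inj₁ t1w≡w = fpf1 M w t1w≡w
    ... | inj₂ t1w≡t2w = ¬at (subst InHalfEdge (t1-injective M (trans t1w≡t2w (inv2 M (t1 M y)))) at-w)
    back : t1 M (t2 M (t1 M (t1 M w))) ≡ y
    back = trans (cong (λ u → t1 M (t2 M u)) (inv1 M w)) (trans (cong (t1 M) (inv2 M (t1 M y))) (inv1 M y))
  ... | away ¬at ¬at₁ eq =
    trans (cong t1′ eq) (trans (t1′-away ¬at₁ (¬at ∘ subst InHalfEdge (inv1 M y))) (inv1 M y))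

  t1′-fpf : ∀ y → t1′ y ≢ y
  t1′-fpf y with t1′-view y
  ... | in-half-edge _ eq = fpf2 M y ∘ trans (sym eq)
  ... | next-to-half-edge _ _ eq = λ e → fpf2 M (t1 M y) (t1-flip M (trans (sym eq) e))
  ... | away _ _ eq = fpf1 M y ∘ trans (sym eq)

  detached : Map
  detached = record
    { m = m M ; t0 = t0 M ; t1 = t1′ ; t2 = t2 M
    ; inv0 = inv0 M ; inv1 = t1′-inv ; inv2 = inv2 M
    ; fpf0 = fpf0 M ; fpf1 = t1′-fpf ; fpf2 = fpf2 M
    ; comm02 = comm02 M ; fpf02 = fpf02 M }

  module _ {A : Rel (Fin (m M)) 0ℓ} (isEq : IsEquivalence A) where
    open IsEquivalence isEq using () renaming (refl to ∼-refl; sym to ∼-sym)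
    private
      ≡⇒A : ∀ {x y} → x ≡ y → A x y
      ≡⇒A refl = ∼-refl

      merge-trans : ∀ {x y z} → Merge A p q x y → Merge A p q y z → Merge A p q x z
      merge-trans = IsEquivalence.trans (Merge-isEquivalence isEq)
      pair-merged : ∀ {y} → InHalfEdge y → Merge A p q y (t2 M y)
      pair-merged (inj₁ refl) = inj₂ (inj₁ (∼-refl , ∼-refl))
      pair-merged (inj₂ refl) = inj₂ (inj₂ (∼-refl , ≡⇒A (sym (inv2 M p))))

    t1′-merged : (∀ z → A z (t1 M z)) → ∀ y → Merge A p q y (t1′ y)
    t1′-merged A∋t1 y with t1′-view y
    ... | in-half-edge at eq = subst (Merge A p q y) (sym eq) (pair-merged at)
    ... | next-to-half-edge _ at₁ eq = subst (Merge A p q y) (sym eq)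
      (merge-trans (inj₁ (A∋t1 y)) (merge-trans (pair-merged at₁) (inj₁ (A∋t1 _))))
    ... | away _ _ eq = inj₁ (subst (A y) (sym eq) (A∋t1 y))

    t1′-within : (∀ z → A z (t1 M z)) → A p q → ∀ y → A y (t1′ y)
    t1′-within A∋t1 pq y = Merge-collapse isEq pq (t1′-merged A∋t1 y)

    module _ (A∋t1′ : ∀ z → A z (t1′ z)) where
      private
        A-pq : A p q
        A-pq = subst (A p) (t1′-at (inj₁ refl)) (A∋t1′ p)
        A-t1p-t1q : A (t1 M p) (t1 M q)
        A-t1p-t1q with inHalfEdge? (t1 M p)
        ... | yes (inj₁ t1p≡p) = contradiction t1p≡p (fpf1 M p)
        ... | yes (inj₂ t1p≡q) = subst₂ A (sym t1p≡q) (t1-flip M t1p≡q) (∼-sym A-pq)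
        ... | no ¬at = subst (A (t1 M p)) t1′-t1p (A∋t1′ (t1 M p))
          where
          t1′-t1p : t1′ (t1 M p) ≡ t1 M q
          t1′-t1p = trans (t1′-next ¬at (subst InHalfEdge (sym (inv1 M p)) (inj₁ refl)))
                          (cong (λ u → t1 M (t2 M u)) (inv1 M p))

      t1-merged : ∀ y → Merge A p (t1 M p) y (t1 M y)
      t1-merged y with t1′-view y
      ... | in-half-edge (inj₁ refl) _ = inj₂ (inj₁ (∼-refl , ∼-refl))
      ... | in-half-edge (inj₂ refl) _ = inj₂ (inj₁ (∼-sym A-pq , A-t1p-t1q))
      ... | next-to-half-edge _ (inj₁ t1y≡p) _ = inj₂ (inj₂ (≡⇒A (t1-flip M t1y≡p) , ≡⇒A (sym t1y≡p)))
      ... | next-to-half-edge _ (inj₂ t1y≡q) _ =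
        inj₂ (inj₂ ( subst (λ u → A u (t1 M p)) (sym (t1-flip M t1y≡q)) (∼-sym A-t1p-t1q)
                   , subst (A p) (sym t1y≡q) A-pq))
      ... | away _ _ eq = inj₁ (subst (A y) eq (A∋t1′ y))

  private
    isEqVM : IsEquivalence (VertexOrb M)
    isEqVM = VertexOrb-isEquivalence M
    isEqVD : IsEquivalence (VertexOrb detached)
    isEqVD = VertexOrb-isEquivalence detached
    isEqFM : IsEquivalence (FaceOrb M)
    isEqFM = FaceOrb-isEquivalence M
    isEqFD : IsEquivalence (FaceOrb detached)
    isEqFD = FaceOrb-isEquivalence detached
    isEqCD : IsEquivalence (CompOrb detached)
    isEqCD = CompOrb-isEquivalence detached

  vertexOrb-detached⇒ : VertexOrb detached ⇒ VertexOrb M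
  vertexOrb-detached⇒ = orbit₂-least isEqVM (t1′-within isEqVM orbit₂-f (orbit₂-g p)) orbit₂-g

  vertexOrb⇒merged : VertexOrb M ⇒ Merge (VertexOrb detached) p (t1 M p)
  vertexOrb⇒merged = orbit₂-least (Merge-isEquivalence isEqVD) (t1-merged isEqVD orbit₂-f) (inj₁ ∘ orbit₂-g)

  faceOrb-detached⇒merged : FaceOrb detached ⇒ Merge (FaceOrb M) p q
  faceOrb-detached⇒merged =
    orbit₂-least (Merge-isEquivalence isEqFM) (inj₁ ∘ orbit₂-f) (t1′-merged isEqFM orbit₂-g)

  faceOrb-detached⇒ : FaceOrb M p q → FaceOrb detached ⇒ FaceOrb M
  faceOrb-detached⇒ pq = orbit₂-least isEqFM orbit₂-f (t1′-within isEqFM orbit₂-g pq)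

  compOrb⇒merged : CompOrb M ⇒ Merge (CompOrb detached) p (t1 M p)
  compOrb⇒merged =
    orbit₃-least (Merge-isEquivalence isEqCD) (inj₁ ∘ orbit₃-f) (t1-merged isEqCD orbit₃-g) (inj₁ ∘ orbit₃-h)

  vertexOrb-detached-of-p : ∀ {y} → VertexOrb detached p y → InHalfEdge y
  vertexOrb-detached-of-p path = star-closed InHalfEdge closed path (inj₁ refl)
    where
    closed : ∀ {x y} → Step₂ t1′ (t2 M) x y → InHalfEdge x → InHalfEdge y
    closed (inj₁ refl) at = subst InHalfEdge (sym (t1′-at at)) (InHalfEdge-t2 at)
    closed (inj₂ refl) at = InHalfEdge-t2 at

  -- Parity argument: the flags sharing a face of M and a component of the detached map
  -- with t1 p form a t0-closed, hence even, set; if p and q lay on different faces of M,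
  -- removing t1 p from it would leave a t1-closed, hence even, set.
  split⇒same-face : ∀ {F K} → NumClasses (FaceOrb M) F → NumClasses (CompOrb detached) K →
                    ¬ CompOrb detached p (t1 M p) → FaceOrb M p q
  split⇒same-face NF NK split with R? NF p q
  ... | yes pq = pq
  ... | no ¬pq = ⊥-elim (even⇒¬odd (count-even (inv1 M) (fpf1 M) T′ T′-t1)
                   (subst (2 ∣_) (count-─ T (t1 M p) T∋t1p) (count-even (inv0 M) (fpf0 M) T T-t0)))
    where
    open IsEquivalence isEqFM using () renaming (sym to F-sym; trans to F-trans)
    open IsEquivalence isEqCD using () renaming (sym to C-sym; trans to C-trans)
    near? : ∀ x → Dec (FaceOrb M x (t1 M p) × CompOrb detached x (t1 M p))
    near? x = R? NF x (t1 M p) ×-dec R? NK x (t1 M p)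
    T : Fin (m M) → Bool
    T x = does (near? x)
    T∋t1p : T (t1 M p) ≡ true
    T∋t1p = dec-true (near? (t1 M p)) (ε , ε)
    T-t0 : ∀ x → T x ≡ true → T (t0 M x) ≡ true
    T-t0 x Tx = let (fx , cx) = does≡true⇒ (near? x) Tx in
      dec-true (near? (t0 M x)) (F-trans (F-sym (orbit₂-f x)) fx , C-trans (C-sym (orbit₃-f x)) cx)
    T′ : Fin (m M) → Bool
    T′ = T ─ t1 M p
    T′-t1 : ∀ x → T′ x ≡ true → T′ (t1 M x) ≡ true
    T′-t1 x T′x with ─-sound T (t1 M p) T′x
    ... | Tx , x≢t1p with does≡true⇒ (near? x) Tx
    ...   | fx , cx = ─-complete T (t1 M p) T-t1x (x≢p ∘ t1-injective M)
      where
      x≢p : x ≢ p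
      x≢p refl = split cx
      ¬at : ¬ InHalfEdge x
      ¬at (inj₁ x≡p) = x≢p x≡p
      ¬at (inj₂ refl) = split (C-trans (orbit₃-h p) cx)
      ¬at₁ : ¬ InHalfEdge (t1 M x)
      ¬at₁ (inj₁ t1x≡p) = x≢t1p (t1-flip M t1x≡p)
      ¬at₁ (inj₂ t1x≡q) = ¬pq (F-sym (F-trans (subst (FaceOrb M q) (sym (t1-flip M t1x≡q)) (orbit₂-g q))
                                               (F-trans fx (F-sym (orbit₂-g p)))))
      T-t1x : T (t1 M x) ≡ true
      T-t1x = dec-true (near? (t1 M x))
        ( F-trans (F-sym (orbit₂-g x)) fx
        , C-trans (C-sym (subst (CompOrb detached x) (t1′-away ¬at ¬at₁) (orbit₃-g x))) cx)

  private
    vertexOrb-detached-t1p : t1 M p ≢ q → ¬ VertexOrb detached p (t1 M p)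
    vertexOrb-detached-t1p ¬pendant path with vertexOrb-detached-of-p path
    ... | inj₁ t1p≡p = fpf1 M p t1p≡p
    ... | inj₂ t1p≡q = ¬pendant t1p≡q

  module Counts (C′ : CellCounts detached) (C : CellCounts M) where
    open CellCounts

    private
      K′≤K : CompOrb detached p (t1 M p) → K C′ ≤ K C
      K′≤K joined = classes-antimono isEqCD (Merge-collapse isEqCD joined ∘ compOrb⇒merged)
                                     (components C) (components C′)

      K′≤1+K : K C′ ≤ suc (K C)
      K′≤1+K = classes-merge isEqCD compOrb⇒merged (components C) (components C′)

      E′≤E : E C′ ≤ E C
      E′≤E = classes-antimono (EdgeOrb-isEquivalence detached) id (edges C) (edges C′)

      V≤V′ : V C ≤ V C′
      V≤V′ = classes-antimono isEqVM vertexOrb-detached⇒ (vertices C′) (vertices C)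

      V<V′ : t1 M p ≢ q → suc (V C) ≤ V C′
      V<V′ ¬pendant = classes-split isEqVM (IsEquivalence.sym isEqVD) vertexOrb-detached⇒ (orbit₂-f p)
                                    (vertexOrb-detached-t1p ¬pendant) (vertices C) (vertices C′)

      F≤F′ : FaceOrb M p q → F C ≤ F C′
      F≤F′ pq = classes-antimono isEqFM (faceOrb-detached⇒ pq) (faces C′) (faces C)

      F≤1+F′ : F C ≤ suc (F C′)
      F≤1+F′ = classes-merge isEqFM faceOrb-detached⇒merged (faces C′) (faces C)

      F<F′ : ¬ CompOrb detached p (t1 M p) → suc (F C) ≤ F C′
      F<F′ split = classes-split isEqFM (IsEquivalence.sym isEqFD)
                                 (faceOrb-detached⇒ (split⇒same-face (faces C) (components C′) split))
                                 (orbit₂-g p) (split ∘ FaceOrb⇒CompOrb detached) (faces C) (faces C′)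

    genus-≤ : 2 * K C′ + E C′ + (V C + F C) ≤ 2 * K C + E C + (V C′ + F C′)
    genus-≤ with t1 M p ≟ q | R? (components C′) p (t1 M p)
    ... | yes pendant | _ = genus-≤-mono (K′≤K (subst (CompOrb detached p) (sym pendant) (orbit₃-h p)))
                                         E′≤E V≤V′ (F≤F′ (subst (FaceOrb M p) pendant (orbit₂-g p)))
    ... | no ¬pendant | yes joined = genus-≤-vertex-for-face (K′≤K joined) E′≤E (V<V′ ¬pendant) F≤1+F′
    ... | no ¬pendant | no split = genus-≤-vertex-face-for-component K′≤1+K E′≤E (V<V′ ¬pendant) (F<F′ split)

  detached-≼ : detached ≼ M
  detached-≼ = Counts.genus-≤

record Complement {k : ℕ} (K : Fin k → Set) : Set where
  field
    size : ℕ
    embed : Fin size → Fin k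
    embed-injective : ∀ {x y} → embed x ≡ embed y → x ≡ y
    embed-avoids : ∀ x → ¬ K (embed x)
    embed-onto : ∀ y → ¬ K y → ∃ λ x → embed x ≡ y

complement : (K : Fin k → Set) → (∀ y → Dec (K y)) → Complement K
complement {zero} K _ = record
  { size = 0 ; embed = λ () ; embed-injective = λ {x} → contradiction x ¬Fin0
  ; embed-avoids = λ () ; embed-onto = λ () }
complement {suc k} K K? with complement (K ∘ suc) (K? ∘ suc) | K? zero
... | C | yes K0 = record
  { size = size ; embed = suc ∘ embed ; embed-injective = embed-injective ∘ suc-injective
  ; embed-avoids = embed-avoids ; embed-onto = onto }
  where
  open Complement C
  onto : ∀ y → ¬ K y → ∃ λ x → suc (embed x) ≡ y
  onto zero ¬K0 = contradiction K0 ¬K0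
  onto (suc y) ¬Ky = let (x , eq) = embed-onto y ¬Ky in x , cong suc eq
... | C | no ¬K0 = record
  { size = suc size ; embed = embed₀ ; embed-injective = injective ; embed-avoids = avoids ; embed-onto = onto }
  where
  open Complement C
  embed₀ : Fin (suc size) → Fin (suc k)
  embed₀ zero = zero
  embed₀ (suc x) = suc (embed x)
  injective : ∀ {x y} → embed₀ x ≡ embed₀ y → x ≡ y
  injective {zero} {zero} _ = refl
  injective {suc x} {suc y} eq = cong suc (embed-injective (suc-injective eq))
  avoids : ∀ x → ¬ K (embed₀ x)
  avoids zero = ¬K0
  avoids (suc x) = embed-avoids x
  onto : ∀ y → ¬ K y → ∃ λ x → embed₀ x ≡ y
  onto zero _ = zero , refl
  onto (suc y) ¬Ky = let (x , eq) = embed-onto y ¬Ky in suc x , cong suc eq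

-- When both ends of the edge of flag a are pendant (t1 = t2 there), its four flags
-- form a component with two vertices, one edge and one face; it can be cut out.
module RemoveEdge (M : Map) (a : Fin (m M))
                  (a-pendant : t1 M a ≡ t2 M a) (a₀-pendant : t1 M (t0 M a) ≡ t2 M (t0 M a)) where

  a₀ a₂ a₂₀ : Fin (m M)
  a₀ = t0 M a
  a₂ = t2 M a
  a₂₀ = t0 M a₂

  InEdge : Fin (m M) → Set
  InEdge y = y ≡ a ⊎ y ≡ a₀ ⊎ y ≡ a₂ ⊎ y ≡ a₂₀

  inEdge? : ∀ y → Dec (InEdge y)
  inEdge? y = (y ≟ a) ⊎-dec (y ≟ a₀) ⊎-dec (y ≟ a₂) ⊎-dec (y ≟ a₂₀)

  t2a₀≡a₂₀ : t2 M a₀ ≡ a₂₀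
  t2a₀≡a₂₀ = sym (comm02 M a)

  t2a₂₀≡a₀ : t2 M a₂₀ ≡ a₀
  t2a₂₀≡a₀ = trans (sym (comm02 M a₂)) (cong (t0 M) (inv2 M a))

  t1a₂≡a : t1 M a₂ ≡ a
  t1a₂≡a = trans (cong (t1 M) (sym a-pendant)) (inv1 M a)

  t1a₂₀≡a₀ : t1 M a₂₀ ≡ a₀
  t1a₂₀≡a₀ = trans (cong (t1 M) (sym (trans a₀-pendant t2a₀≡a₂₀))) (inv1 M a₀)

  InEdge-t0 : ∀ {y} → InEdge y → InEdge (t0 M y)
  InEdge-t0 (inj₁ refl) = inj₂ (inj₁ refl)
  InEdge-t0 (inj₂ (inj₁ refl)) = inj₁ (inv0 M a)
  InEdge-t0 (inj₂ (inj₂ (inj₁ refl))) = inj₂ (inj₂ (inj₂ refl))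
  InEdge-t0 (inj₂ (inj₂ (inj₂ refl))) = inj₂ (inj₂ (inj₁ (inv0 M a₂)))

  InEdge-t1 : ∀ {y} → InEdge y → InEdge (t1 M y)
  InEdge-t1 (inj₁ refl) = inj₂ (inj₂ (inj₁ a-pendant))
  InEdge-t1 (inj₂ (inj₁ refl)) = inj₂ (inj₂ (inj₂ (trans a₀-pendant t2a₀≡a₂₀)))
  InEdge-t1 (inj₂ (inj₂ (inj₁ refl))) = inj₁ t1a₂≡a
  InEdge-t1 (inj₂ (inj₂ (inj₂ refl))) = inj₂ (inj₁ t1a₂₀≡a₀)

  InEdge-t2 : ∀ {y} → InEdge y → InEdge (t2 M y)
  InEdge-t2 (inj₁ refl) = inj₂ (inj₂ (inj₁ refl))
  InEdge-t2 (inj₂ (inj₁ refl)) = inj₂ (inj₂ (inj₂ t2a₀≡a₂₀))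
  InEdge-t2 (inj₂ (inj₂ (inj₁ refl))) = inj₁ (inv2 M a)
  InEdge-t2 (inj₂ (inj₂ (inj₂ refl))) = inj₂ (inj₁ t2a₂₀≡a₀)

  open Complement (complement InEdge inEdge?) public
    renaming (size to m′; embed to ι; embed-injective to ι-injective; embed-avoids to ι-avoids; embed-onto to ι-onto)

  private
    Restriction : (Fin (m M) → Fin (m M)) → Set
    Restriction f = Σ (Fin m′ → Fin m′) λ f′ → ∀ x → ι (f′ x) ≡ f (ι x)

    restrict : (f : Fin (m M) → Fin (m M)) → (∀ y → f (f y) ≡ y) → (∀ {y} → InEdge y → InEdge (f y)) →
               Restriction f
    restrict f f-inv closed = (λ x → proj₁ (lift x)) , (λ x → proj₂ (lift x))
      where
      lift : ∀ x → ∃ λ x′ → ι x′ ≡ f (ι x)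
      lift x = ι-onto (f (ι x)) (λ in-f → ι-avoids x (subst InEdge (f-inv (ι x)) (closed in-f)))

    r0 : Restriction (t0 M)
    r0 = restrict (t0 M) (inv0 M) InEdge-t0
    r1 : Restriction (t1 M)
    r1 = restrict (t1 M) (inv1 M) InEdge-t1
    r2 : Restriction (t2 M)
    r2 = restrict (t2 M) (inv2 M) InEdge-t2

  s0 s1 s2 : Fin m′ → Fin m′
  s0 = proj₁ r0
  s1 = proj₁ r1
  s2 = proj₁ r2

  ι-s0 : ∀ x → ι (s0 x) ≡ t0 M (ι x)
  ι-s0 = proj₂ r0
  ι-s1 : ∀ x → ι (s1 x) ≡ t1 M (ι x)
  ι-s1 = proj₂ r1
  ι-s2 : ∀ x → ι (s2 x) ≡ t2 M (ι x)
  ι-s2 = proj₂ r2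

  private
    module _ {f : Fin (m M) → Fin (m M)} {f′ : Fin m′ → Fin m′}
             (ι-f′ : ∀ x → ι (f′ x) ≡ f (ι x)) where
      inv-restrict : (∀ y → f (f y) ≡ y) → ∀ x → f′ (f′ x) ≡ x
      inv-restrict f-inv x = ι-injective (trans (ι-f′ (f′ x)) (trans (cong f (ι-f′ x)) (f-inv (ι x))))
      fpf-restrict : (∀ y → f y ≢ y) → ∀ x → f′ x ≢ x
      fpf-restrict f-fpf x eq = f-fpf (ι x) (trans (sym (ι-f′ x)) (cong ι eq))

  removed : Map
  removed = record
    { m = m′ ; t0 = s0 ; t1 = s1 ; t2 = s2
    ; inv0 = inv-restrict {t0 M} ι-s0 (inv0 M)
    ; inv1 = inv-restrict {t1 M} ι-s1 (inv1 M)
    ; inv2 = inv-restrict {t2 M} ι-s2 (inv2 M)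
    ; fpf0 = fpf-restrict {t0 M} ι-s0 (fpf0 M)
    ; fpf1 = fpf-restrict {t1 M} ι-s1 (fpf1 M)
    ; fpf2 = fpf-restrict {t2 M} ι-s2 (fpf2 M)
    ; comm02 = λ x → ι-injective (trans (ι-s0 (s2 x)) (trans (cong (t0 M) (ι-s2 x))
                       (trans (comm02 M (ι x)) (trans (cong (t2 M) (sym (ι-s0 x))) (sym (ι-s2 (s0 x)))))))
    ; fpf02 = λ x eq → fpf02 M (ι x) (trans (cong (t0 M) (sym (ι-s2 x))) (trans (sym (ι-s0 (s2 x))) (cong ι eq))) }

  vertex-removed⇒ : ∀ {x y} → VertexOrb removed x y → VertexOrb M (ι x) (ι y)
  vertex-removed⇒ = step₂-map ι-s1 ι-s2

  vertex⇒removed : ∀ {x y} → VertexOrb M (ι x) (ι y) → VertexOrb removed x y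
  vertex⇒removed = step₂-reflect ι-injective ι-s1 ι-s2

  edge⇒removed : ∀ {x y} → EdgeOrb M (ι x) (ι y) → EdgeOrb removed x y
  edge⇒removed = step₂-reflect ι-injective ι-s0 ι-s2

  face-removed⇒ : ∀ {x y} → FaceOrb removed x y → FaceOrb M (ι x) (ι y)
  face-removed⇒ = step₂-map ι-s0 ι-s1

  component⇒removed : ∀ {x y} → CompOrb M (ι x) (ι y) → CompOrb removed x y
  component⇒removed = step₃-reflect ι-injective ι-s0 ι-s1 ι-s2

  edge-of-a : ∀ {y} → EdgeOrb M a y → InEdge y
  edge-of-a path = star-closed InEdge (λ { (inj₁ refl) → InEdge-t0 ; (inj₂ refl) → InEdge-t2 }) path (inj₁ refl)

  component-of-a : ∀ {y} → CompOrb M a y → InEdge y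
  component-of-a path = star-closed InEdge
    (λ { (inj₁ refl) → InEdge-t0 ; (inj₂ (inj₁ refl)) → InEdge-t1 ; (inj₂ (inj₂ refl)) → InEdge-t2 })
    path (inj₁ refl)

  removed-≼ : removed ≼ M
  removed-≼ C′ C = genus-≤-drop-edge-component
    (classes-restrict-drop ι-avoids (CompOrb-isEquivalence M) component⇒removed a component-of-a
                           (components C) (components C′))
    (classes-restrict-drop ι-avoids (EdgeOrb-isEquivalence M) edge⇒removed a edge-of-a (edges C) (edges C′))
    (classes-restrict ι-avoids (VertexOrb-isEquivalence M) ι-onto vertex-removed⇒ ends ends-cover
                      (vertices C) (vertices C′))
    (classes-restrict ι-avoids (FaceOrb-isEquivalence M) ι-onto face-removed⇒ (λ _ → a) face-cover
                      (faces C) (faces C′))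
    where
    open CellCounts
    ends : Fin 2 → Fin (m M)
    ends zero = a
    ends (suc _) = a₀
    ends-cover : ∀ y → InEdge y → ∃ λ i → VertexOrb M y (ends i)
    ends-cover _ (inj₁ refl) = zero , ε
    ends-cover _ (inj₂ (inj₁ refl)) = suc zero , ε
    ends-cover _ (inj₂ (inj₂ (inj₁ refl))) = zero , inj₂ (inv2 M a) ◅ ε
    ends-cover _ (inj₂ (inj₂ (inj₂ refl))) = suc zero , inj₂ t2a₂₀≡a₀ ◅ ε
    face-cover : ∀ y → InEdge y → ∃ λ (i : Fin 1) → FaceOrb M y a
    face-cover _ (inj₁ refl) = zero , ε
    face-cover _ (inj₂ (inj₁ refl)) = zero , inj₁ (inv0 M a) ◅ ε
    face-cover _ (inj₂ (inj₂ (inj₁ refl))) = zero , inj₂ t1a₂≡a ◅ ε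
    face-cover _ (inj₂ (inj₂ (inj₂ refl))) = zero , inj₁ (inv0 M a₂) ◅ inj₂ t1a₂≡a ◅ ε

-- Deleting edges and vertices

Link : ∀ {N} → Fin N → Fin N → Fin N → Fin N → Set
Link v w x y = (x ≡ v × y ≡ w) ⊎ (x ≡ w × y ≡ v)

link? : ∀ {N} (v w x y : Fin N) → Dec (Link v w x y)
link? v w x y = ((x ≟ v) ×-dec (y ≟ w)) ⊎-dec ((x ≟ w) ×-dec (y ≟ v))

Link-sym : ∀ {N} {v w x y : Fin N} → Link v w x y → Link v w y x
Link-sym (inj₁ (x≡v , y≡w)) = inj₂ (y≡w , x≡v)
Link-sym (inj₂ (x≡w , y≡v)) = inj₁ (y≡v , x≡w)

deleteEdge : (G : Graph) → Fin (n G) → Fin (n G) → Graph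
deleteEdge G v w = record
  { n = n G
  ; adj = λ x y → adj G x y ∧ not (does (link? v w x y))
  ; sym = λ x y → cong₂ (λ b l → b ∧ not l) (adj-sym G x y)
                        (does-⇔ (mk⇔ Link-sym Link-sym) (link? v w x y) (link? v w y x))
  ; irrefl = λ x → cong (λ b → b ∧ not (does (link? v w x x))) (irrefl G x) }

module _ (G : Graph) (v w : Fin (n G)) {x y : Fin (n G)} where

  deleteEdge-adj⇒ : adj (deleteEdge G v w) x y ≡ true → adj G x y ≡ true × ¬ Link v w x y
  deleteEdge-adj⇒ adj′ =
    let (adjxy , unlinked) = ∧-not⇒ adj′ in adjxy , does≡false⇒ (link? v w x y) unlinked

  deleteEdge-adj⇐ : adj G x y ≡ true → ¬ Link v w x y → adj (deleteEdge G v w) x y ≡ true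
  deleteEdge-adj⇐ adjxy ¬link rewrite adjxy | dec-false (link? v w x y) ¬link = refl

  deleteEdge-away : x ≢ v → y ≢ v → adj (deleteEdge G v w) x y ≡ adj G x y
  deleteEdge-away x≢v y≢v =
    trans (cong (λ l → adj G x y ∧ not l) (dec-false (link? v w x y) ¬link)) (∧-identityʳ (adj G x y))
    where
    ¬link : ¬ Link v w x y
    ¬link (inj₁ (x≡v , _)) = x≢v x≡v
    ¬link (inj₂ (_ , y≡v)) = y≢v y≡v

module DeleteEdge (G : Graph) (M : Map) (vtx : Fin (m M) → Fin (n G)) (realizes : Realizes M G vtx)
                  (a : Fin (m M)) where

  open Realization {M} {G} {vtx} realizes

  v w : Fin (n G)
  v = vtx a
  w = vtx (t0 M a)

  M₁ M₂ : Map
  M₁ = Detach.detached M a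
  M₂ = Detach.detached M₁ (t0 M a)

  private
    a≢a₀ : a ≢ t0 M a
    a≢a₀ = fpf0 M a ∘ sym
    a≢a₀₂ : a ≢ t2 M (t0 M a)
    a≢a₀₂ eq = fpf02 M a (trans (comm02 M a) (sym eq))
    a₂≢a₀ : t2 M a ≢ t0 M a
    a₂≢a₀ eq = fpf02 M a (trans (cong (t0 M) eq) (inv0 M a))
    a₂≢a₀₂ : t2 M a ≢ t2 M (t0 M a)
    a₂≢a₀₂ eq = a≢a₀ (trans (sym (inv2 M a)) (trans (cong (t2 M) eq) (inv2 M (t0 M a))))

    a-pendant : t1 M₂ a ≡ t2 M₂ a
    a-pendant = trans (Detach.t1′-away M₁ (t0 M a) ¬at ¬at₁) t1₁a≡a₂
      where
      t1₁a≡a₂ : t1 M₁ a ≡ t2 M a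
      t1₁a≡a₂ = Detach.t1′-at M a (inj₁ refl)
      ¬at : ¬ Detach.InHalfEdge M₁ (t0 M a) a
      ¬at (inj₁ eq) = a≢a₀ eq
      ¬at (inj₂ eq) = a≢a₀₂ eq
      ¬at₁ : ¬ Detach.InHalfEdge M₁ (t0 M a) (t1 M₁ a)
      ¬at₁ (inj₁ eq) = a₂≢a₀ (trans (sym t1₁a≡a₂) eq)
      ¬at₁ (inj₂ eq) = a₂≢a₀₂ (trans (sym t1₁a≡a₂) eq)

    a₀-pendant : t1 M₂ (t0 M a) ≡ t2 M₂ (t0 M a)
    a₀-pendant = Detach.t1′-at M₁ (t0 M a) (inj₁ refl)

  open RemoveEdge M₂ a a-pendant a₀-pendant

  M′ : Map
  M′ = removed

  vtx′ : Fin (m M′) → Fin (n G)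
  vtx′ = vtx ∘ ι

  fewer-flags : m M′ < m M
  fewer-flags = injective⇒≤ {f = extend} injective
    where
    extend : Fin (suc (m M′)) → Fin (m M)
    extend zero = a
    extend (suc x) = ι x
    injective : ∀ {x y} → extend x ≡ extend y → x ≡ y
    injective {zero} {zero} _ = refl
    injective {zero} {suc y} eq = contradiction (inj₁ (sym eq)) (ι-avoids y)
    injective {suc x} {zero} eq = contradiction (inj₁ eq) (ι-avoids x)
    injective {suc x} {suc y} eq = cong suc (ι-injective eq)

  M′-genus : ∀ {g} → EulerGenusAtMost g M → DoubleNegation (EulerGenusAtMost g M′)
  M′-genus bound = do
    bound₁ ← genus-≼ (Detach.detached-≼ M a) bound
    bound₂ ← genus-≼ (Detach.detached-≼ M₁ (t0 M a)) bound₁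
    genus-≼ removed-≼ bound₂

  private
    edge-sym : ∀ {x y} → EdgeOrb M x y → EdgeOrb M y x
    edge-sym = IsEquivalence.sym (EdgeOrb-isEquivalence M)

    vtx-a₂ : vtx a₂ ≡ v
    vtx-a₂ = proj₂ (same-vertex⇔ _ _) (inj₂ (inv2 M a) ◅ ε)
    vtx-a₂₀ : vtx a₂₀ ≡ w
    vtx-a₂₀ = proj₂ (same-vertex⇔ _ _) (inj₂ t2a₂₀≡a₀ ◅ ε)

    edge-flag-links : ∀ {y} → InEdge y → Link v w (vtx y) (vtx (t0 M y))
    edge-flag-links (inj₁ refl) = inj₁ (refl , refl)
    edge-flag-links (inj₂ (inj₁ refl)) = inj₂ (refl , cong vtx (inv0 M a))
    edge-flag-links (inj₂ (inj₂ (inj₁ refl))) = inj₁ (vtx-a₂ , vtx-a₂₀)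
    edge-flag-links (inj₂ (inj₂ (inj₂ refl))) = inj₂ (vtx-a₂₀ , trans (cong vtx (inv0 M a₂)) vtx-a₂)

    linked-flag-in-edge : ∀ {y} → Link v w (vtx y) (vtx (t0 M y)) → InEdge y
    linked-flag-in-edge {y} (inj₁ (y≡v , t0y≡w)) = edge-of-a (edge-sym (flags-share-edge y a y≡v t0y≡w))
    linked-flag-in-edge {y} (inj₂ (y≡w , t0y≡v)) =
      edge-of-a (orbit₂-f a ◅◅ edge-sym (flags-share-edge y (t0 M a) y≡w
                                                          (trans t0y≡v (cong vtx (sym (inv0 M a))))))

    off-edge : ∀ x → ¬ VertexOrb M₁ a (ι x)
    off-edge x path with Detach.vertexOrb-detached-of-p M a path
    ... | inj₁ eq = ι-avoids x (inj₁ eq)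
    ... | inj₂ eq = ι-avoids x (inj₂ (inj₂ (inj₁ eq)))

    off-edge₀ : ∀ x → ¬ VertexOrb M₂ (t0 M a) (ι x)
    off-edge₀ x path with Detach.vertexOrb-detached-of-p M₁ (t0 M a) path
    ... | inj₁ eq = ι-avoids x (inj₂ (inj₁ eq))
    ... | inj₂ eq = ι-avoids x (inj₂ (inj₂ (inj₂ (trans eq t2a₀≡a₂₀))))

  realizes′ : Realizes M′ (deleteEdge G v w) vtx′
  realizes′ = same-vertex′ , flag-adjacent′ , edge-has-flag′ , flags-share-edge′
    where
    sym₁ : ∀ {x y} → VertexOrb M₁ x y → VertexOrb M₁ y x
    sym₁ = IsEquivalence.sym (VertexOrb-isEquivalence M₁)
    sym₂ : ∀ {x y} → VertexOrb M₂ x y → VertexOrb M₂ y x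
    sym₂ = IsEquivalence.sym (VertexOrb-isEquivalence M₂)
    same-vertex′ : ∀ x y → (vtx′ x ≡ vtx′ y → VertexOrb M′ x y)
                         × (VertexOrb M′ x y → vtx′ x ≡ vtx′ y)
    same-vertex′ x y = to , from
      where
      to : vtx′ x ≡ vtx′ y → VertexOrb M′ x y
      to eq = vertex⇒removed
        (Merge-away (VertexOrb-isEquivalence M₂) (off-edge₀ x ∘ sym₂) (off-edge₀ y ∘ sym₂)
          (Detach.vertexOrb⇒merged M₁ (t0 M a)
            (Merge-away (VertexOrb-isEquivalence M₁) (off-edge x ∘ sym₁) (off-edge y ∘ sym₁)
              (Detach.vertexOrb⇒merged M a (proj₁ (same-vertex⇔ (ι x) (ι y)) eq)))))
      from : VertexOrb M′ x y → vtx′ x ≡ vtx′ y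
      from = proj₂ (same-vertex⇔ (ι x) (ι y)) ∘ Detach.vertexOrb-detached⇒ M a
           ∘ Detach.vertexOrb-detached⇒ M₁ (t0 M a) ∘ vertex-removed⇒
    flag-adjacent′ : ∀ x → adj (deleteEdge G v w) (vtx′ x) (vtx′ (t0 M′ x)) ≡ true
    flag-adjacent′ x rewrite ι-s0 x =
      deleteEdge-adj⇐ G v w (flag-adjacent (ι x)) (ι-avoids x ∘ linked-flag-in-edge)
    edge-has-flag′ : ∀ u z → adj (deleteEdge G v w) u z ≡ true →
                     ∃ λ x → (vtx′ x ≡ u) × (vtx′ (t0 M′ x) ≡ z)
    edge-has-flag′ u z adj′ with deleteEdge-adj⇒ G v w adj′
    ... | adjuz , ¬link with edge-has-flag u z adjuz
    ...   | y , refl , refl with ι-onto y (¬link ∘ edge-flag-links)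
    ...     | x , refl = x , refl , cong vtx (ι-s0 x)
    flags-share-edge′ : ∀ x y → vtx′ x ≡ vtx′ y → vtx′ (t0 M′ x) ≡ vtx′ (t0 M′ y) → EdgeOrb M′ x y
    flags-share-edge′ x y same same₀ rewrite ι-s0 x | ι-s0 y =
      edge⇒removed (flags-share-edge (ι x) (ι y) same same₀)

-- The invariant while the edges at v are deleted one at a time.
record EmbeddedOffVertex (G : Graph) (v : Fin (n G)) (g : ℕ) : Set where
  field
    A : Fin (n G) → Fin (n G) → Bool
    A-sym : ∀ x y → A x y ≡ A y x
    A-irrefl : ∀ x → A x x ≡ false

  graph : Graph
  graph = record G { adj = A ; sym = A-sym ; irrefl = A-irrefl }

  field
    map : Map
    vtx : Fin (m map) → Fin (n G)
    realizes : Realizes map graph vtx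
    genus : EulerGenusAtMost g map
    agrees : ∀ x y → x ≢ v → y ≢ v → A x y ≡ adj G x y

module _ {G : Graph} {v : Fin (n G)} {g : ℕ} where
  open EmbeddedOffVertex

  deleteEdgeAt : (S : EmbeddedOffVertex G v g) (a : Fin (m (map S))) → vtx S a ≡ v →
                 DoubleNegation (Σ (EmbeddedOffVertex G v g) λ S′ → m (map S′) < m (map S))
  deleteEdgeAt S a at-v = do
    genus′ ← M′-genus (genus S)
    pure (record { A = adj H′ ; A-sym = adj-sym H′ ; A-irrefl = irrefl H′ ; map = M′ ; vtx = vtx′
                 ; realizes = realizes′ ; genus = genus′ ; agrees = agrees′ }
         , fewer-flags)
    where
    open DeleteEdge (graph S) (map S) (vtx S) (realizes S) a using (M′; vtx′; realizes′; M′-genus; fewer-flags)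
    H′ : Graph
    H′ = deleteEdge (graph S) (vtx S a) (vtx S (t0 (map S) a))
    agrees′ : ∀ x y → x ≢ v → y ≢ v → adj H′ x y ≡ adj G x y
    agrees′ x y x≢v y≢v =
      trans (deleteEdge-away (graph S) (vtx S a) _ (x≢v ∘ flip trans at-v) (y≢v ∘ flip trans at-v))
            (agrees S x y x≢v y≢v)

  ¬¬-avoid-vertex : (S : EmbeddedOffVertex G v g) →
                    DoubleNegation (Σ (EmbeddedOffVertex G v g) λ S′ → ∀ x → vtx S′ x ≢ v)
  ¬¬-avoid-vertex S = go (m (map S)) S ≤-refl
    where
    go : ∀ fuel (S : EmbeddedOffVertex G v g) → m (map S) ≤ fuel →
         DoubleNegation (Σ (EmbeddedOffVertex G v g) λ S′ → ∀ x → vtx S′ x ≢ v)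
    go fuel S bound with any? (λ x → vtx S x ≟ v)
    ... | no none = pure (S , λ x at-v → none (x , at-v))
    go zero S bound | yes (a , _) = contradiction (≤-trans (toℕ<n a) bound) λ ()
    go (suc fuel) S bound | yes (a , at-v) = do
      (S′ , smaller) ← deleteEdgeAt S a at-v
      go fuel S′ (ℕ.≤-pred (≤-trans smaller bound))

deleteVertex : (G : Graph) → Fin (n G) → Graph
deleteVertex record { n = suc N ; adj = A ; sym = A-sym ; irrefl = A-irrefl } v = record
  { n = N ; adj = λ x y → A (punchIn v x) (punchIn v y)
  ; sym = λ x y → A-sym (punchIn v x) (punchIn v y) ; irrefl = A-irrefl ∘ punchIn v }

deleteVertex-order : (G : Graph) (v : Fin (n G)) → suc (n (deleteVertex G v)) ≡ n G
deleteVertex-order record { n = suc N } v = refl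

deleteVertex-girth : (G : Graph) (v : Fin (n G)) → GirthAtLeast5 G → GirthAtLeast5 (deleteVertex G v)
deleteVertex-girth record { n = suc N } v (no-triangle , no-square) =
  (λ x y z → no-triangle (punchIn v x) (punchIn v y) (punchIn v z)) ,
  (λ x y z u x≢z y≢u → no-square (punchIn v x) (punchIn v y) (punchIn v z) (punchIn v u)
                          (x≢z ∘ punchIn-injective v x z) (y≢u ∘ punchIn-injective v y u))

deleteVertex-projectivePlanar : (G : Graph) (v : Fin (n G)) →
                                ProjectivePlanar G → DoubleNegation (ProjectivePlanar (deleteVertex G v))
deleteVertex-projectivePlanar G@record { n = suc N ; adj = A₀ } v (M₀ , vtx₀ , realizes₀ , genus₀) = do
  (S , avoids) ← ¬¬-avoid-vertex (record
    { A = A₀ ; A-sym = adj-sym G ; A-irrefl = irrefl G ; map = M₀ ; vtx = vtx₀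
    ; realizes = realizes₀ ; genus = genus₀ ; agrees = λ _ _ _ _ → refl })
  pure (restricted S avoids)
  where
  restricted : (S : EmbeddedOffVertex G v 1) → (∀ x → EmbeddedOffVertex.vtx S x ≢ v) →
               ProjectivePlanar (deleteVertex G v)
  restricted S avoids = map , vtx′ , (same-vertex′ , flag-adjacent′ , edge-has-flag′ , flags-share-edge′) , genus
    where
    open EmbeddedOffVertex S
    open Realization {map} {graph} {vtx} realizes
    vtx′ : Fin (m map) → Fin N
    vtx′ x = punchOut (avoids x ∘ sym)
    punchIn-vtx′ : ∀ x → punchIn v (vtx′ x) ≡ vtx x
    punchIn-vtx′ x = punchIn-punchOut _
    vtx′-injective : ∀ {x y} → vtx′ x ≡ vtx′ y → vtx x ≡ vtx y
    vtx′-injective {x} {y} = punchOut-injective (avoids x ∘ sym) (avoids y ∘ sym)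
    same-vertex′ : ∀ x y → (vtx′ x ≡ vtx′ y → VertexOrb map x y)
                         × (VertexOrb map x y → vtx′ x ≡ vtx′ y)
    same-vertex′ x y = proj₁ (same-vertex⇔ x y) ∘ vtx′-injective , punchOut-cong v ∘ proj₂ (same-vertex⇔ x y)
    flag-adjacent′ : ∀ x → A₀ (punchIn v (vtx′ x)) (punchIn v (vtx′ (t0 map x))) ≡ true
    flag-adjacent′ x rewrite punchIn-vtx′ x | punchIn-vtx′ (t0 map x) =
      trans (sym (agrees _ _ (avoids x) (avoids (t0 map x)))) (flag-adjacent x)
    edge-has-flag′ : ∀ u z → A₀ (punchIn v u) (punchIn v z) ≡ true →
                     ∃ λ x → (vtx′ x ≡ u) × (vtx′ (t0 map x) ≡ z)
    edge-has-flag′ u z adjuz with edge-has-flag (punchIn v u) (punchIn v z)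
                                    (trans (agrees _ _ (punchInᵢ≢i v u) (punchInᵢ≢i v z)) adjuz)
    ... | x , vtx≡u , vtx₀≡z = x , trans (punchOut-cong v vtx≡u) (punchOut-punchIn v)
                                 , trans (punchOut-cong v vtx₀≡z) (punchOut-punchIn v)
    flags-share-edge′ : ∀ x y → vtx′ x ≡ vtx′ y → vtx′ (t0 map x) ≡ vtx′ (t0 map y) → EdgeOrb map x y
    flags-share-edge′ x y same same₀ = flags-share-edge x y (vtx′-injective same) (vtx′-injective same₀)

-- Degrees and colourings

_≟ᶜ_ : (x y : Color) → Dec (x ≡ y)
c1 ≟ᶜ c1 = yes refl
c10 ≟ᶜ c10 = yes refl
c1 ≟ᶜ c10 = no λ ()
c10 ≟ᶜ c1 = no λ ()

c1≢c10 : c1 ≢ c10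
c1≢c10 ()

==ᶜ⇒≡ : ∀ {x y} → (x ==ᶜ y) ≡ true → x ≡ y
==ᶜ⇒≡ {c1} {c1} _ = refl
==ᶜ⇒≡ {c10} {c10} _ = refl

≡⇒==ᶜ : ∀ {x y} → x ≡ y → (x ==ᶜ y) ≡ true
≡⇒==ᶜ {c1} refl = refl
≡⇒==ᶜ {c10} refl = refl

≢⇒==ᶜ : ∀ {x y} → x ≢ y → (x ==ᶜ y) ≡ false
≢⇒==ᶜ {c1} {c1} x≢y = contradiction refl x≢y
≢⇒==ᶜ {c1} {c10} _ = refl
≢⇒==ᶜ {c10} {c1} _ = refl
≢⇒==ᶜ {c10} {c10} x≢y = contradiction refl x≢y

𝟙-∧-≤ : ∀ {a b} → 𝟙 (a ∧ b) ≤ 𝟙 a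
𝟙-∧-≤ {true} {true} = ≤-refl
𝟙-∧-≤ {true} {false} = z≤n
𝟙-∧-≤ {false} = z≤n

𝟙-∧-mono : ∀ {a b c} → (a ≡ true → b ≡ true → c ≡ true) → 𝟙 (a ∧ b) ≤ 𝟙 (a ∧ c)
𝟙-∧-mono {true} {true} b⇒c rewrite b⇒c refl refl = ≤-refl
𝟙-∧-mono {true} {false} _ = z≤n
𝟙-∧-mono {false} _ = z≤n

𝟙-∧-zero : ∀ {a b} → (a ≡ true → b ≡ false) → 𝟙 (a ∧ b) ≡ 0
𝟙-∧-zero {true} ¬b rewrite ¬b refl = refl
𝟙-∧-zero {false} _ = refl

𝟙-∧-< : ∀ {a b} → a ≡ true → b ≡ false → 𝟙 (a ∧ b) < 𝟙 a
𝟙-∧-< refl refl = s≤s z≤n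

module _ (G : Graph) where

  deg-∑ : ∀ x → deg G x ≡ ∑ (λ u → 𝟙 (adj G x u))
  deg-∑ x = sum-allFin (λ u → 𝟙 (adj G x u))

  colorDeg-∑ : ∀ φ x → colorDeg G φ x ≡ ∑ (λ u → 𝟙 (adj G x u ∧ (φ u ==ᶜ φ x)))
  colorDeg-∑ φ x = sum-allFin (λ u → 𝟙 (adj G x u ∧ (φ u ==ᶜ φ x)))

  colorDeg-mono : ∀ {χ ψ} y → (∀ u → adj G y u ≡ true → χ u ≡ χ y → ψ u ≡ ψ y) →
                  colorDeg G χ y ≤ colorDeg G ψ y
  colorDeg-mono {χ} {ψ} y χ⇒ψ = subst₂ _≤_ (sym (colorDeg-∑ χ y)) (sym (colorDeg-∑ ψ y))
    (∑-mono-≤ λ u → 𝟙-∧-mono λ a same → ≡⇒==ᶜ (χ⇒ψ u a (==ᶜ⇒≡ same)))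

  colorDeg≡0 : ∀ {φ} y → (∀ u → adj G y u ≡ true → φ u ≢ φ y) → colorDeg G φ y ≡ 0
  colorDeg≡0 {φ} y differ = trans (colorDeg-∑ φ y) (∑-zero _ λ u → 𝟙-∧-zero (≢⇒==ᶜ ∘ differ u))

  colorDeg<deg : ∀ {φ} y u → adj G y u ≡ true → φ u ≢ φ y → colorDeg G φ y < deg G y
  colorDeg<deg {φ} y u a differ = subst₂ _<_ (sym (colorDeg-∑ φ y)) (sym (deg-∑ y))
    (∑-mono-< (λ _ → 𝟙-∧-≤) u (𝟙-∧-< a (≢⇒==ᶜ differ)))

include : (G : Graph) (v : Fin (n G)) → Fin (n (deleteVertex G v)) → Fin (n G)
include record { n = suc N } v = punchIn v

include-or-v : (G : Graph) (v : Fin (n G)) → ∀ x → x ≡ v ⊎ ∃ λ y → include G v y ≡ x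
include-or-v record { n = suc N } v x with v ≟ x
... | yes v≡x = inj₁ (sym v≡x)
... | no v≢x = inj₂ (punchOut v≢x , punchIn-punchOut v≢x)

deleteVertex-adj : (G : Graph) (v : Fin (n G)) →
                   ∀ x y → adj (deleteVertex G v) x y ≡ adj G (include G v x) (include G v y)
deleteVertex-adj record { n = suc N } v x y = refl

extend : (G : Graph) (v : Fin (n G)) → Color → (Fin (n (deleteVertex G v)) → Color) → Fin (n G) → Color
extend record { n = suc N } v cv χ x with v ≟ x
... | yes _ = cv
... | no v≢x = χ (punchOut v≢x)

extend-v : (G : Graph) (v : Fin (n G)) → ∀ cv χ → extend G v cv χ v ≡ cv
extend-v record { n = suc N } v cv χ with v ≟ v
... | yes _ = refl
... | no v≢v = contradiction refl v≢v

extend-include : (G : Graph) (v : Fin (n G)) → ∀ cv χ y → extend G v cv χ (include G v y) ≡ χ y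
extend-include record { n = suc N } v cv χ y with v ≟ punchIn v y
... | yes v≡y = contradiction (sym v≡y) (punchInᵢ≢i v y)
... | no v≢y = cong χ (punchOut-punchIn v)

deg-include : (G : Graph) (v : Fin (n G)) →
              ∀ y → deg G (include G v y) ≡ 𝟙 (adj G (include G v y) v) + deg (deleteVertex G v) y
deg-include G@record { n = suc N } v y = begin
  deg G (punchIn v y)                               ≡⟨ deg-∑ G (punchIn v y) ⟩
  ∑ f                                               ≡⟨ sum-remove {i = v} f ⟩
  f v + ∑ (f ∘ punchIn v)                           ≡⟨ cong (f v +_) (sym (deg-∑ (deleteVertex G v) y)) ⟩
  f v + deg (deleteVertex G v) y                    ∎
  where
  open ≡-Reasoning
  f : Fin (suc N) → ℕ
  f u = 𝟙 (adj G (punchIn v y) u)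

colorDeg-include : (G : Graph) (v : Fin (n G)) → ∀ cv χ y →
                   colorDeg G (extend G v cv χ) (include G v y)
                   ≡ 𝟙 (adj G (include G v y) v ∧ (cv ==ᶜ χ y)) + colorDeg (deleteVertex G v) χ y
colorDeg-include G@record { n = suc N } v cv χ y = begin
  colorDeg G φ (punchIn v y)                 ≡⟨ colorDeg-∑ G φ (punchIn v y) ⟩
  ∑ f                                        ≡⟨ sum-remove {i = v} f ⟩
  f v + ∑ (f ∘ punchIn v)                    ≡⟨ cong₂ _+_ (f-coloured (extend-v G v cv χ))
                                                          (sum-cong-≗ (f-coloured ∘ extend-include G v cv χ)) ⟩
  to-v + ∑ g                                 ≡⟨ cong (to-v +_) (sym (colorDeg-∑ (deleteVertex G v) χ y)) ⟩
  to-v + colorDeg (deleteVertex G v) χ y     ∎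
  where
  open ≡-Reasoning
  φ : Fin (suc N) → Color
  φ = extend G v cv χ
  f : Fin (suc N) → ℕ
  f u = 𝟙 (adj G (punchIn v y) u ∧ (φ u ==ᶜ φ (punchIn v y)))
  g : Fin N → ℕ
  g u = 𝟙 (adj G (punchIn v y) (punchIn v u) ∧ (χ u ==ᶜ χ y))
  to-v : ℕ
  to-v = 𝟙 (adj G (punchIn v y) v ∧ (cv ==ᶜ χ y))
  f-coloured : ∀ {u c} → φ u ≡ c → f u ≡ 𝟙 (adj G (punchIn v y) u ∧ (c ==ᶜ χ y))
  f-coloured {u} eq =
    cong (λ c → 𝟙 (adj G (punchIn v y) u ∧ c)) (cong₂ _==ᶜ_ eq (extend-include G v cv χ y))

module ExtendColoring (G : Graph) (v : Fin (n G)) (girth : GirthAtLeast5 G)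
                      (v-light : deg G v ≤ 11) (nbrs-light : ∀ u → adj G v u ≡ true → deg G u ≤ 11)
                      (ψ : Fin (n (deleteVertex G v)) → Color)
                      (ψ-valid : ∀ y → colorDeg (deleteVertex G v) ψ y ≤ cap (ψ y)) where

  H : Graph
  H = deleteVertex G v

  ι : Fin (n H) → Fin (n G)
  ι = include G v

  private
    nbr-of-v : ∀ {y} → adj G (ι y) v ≡ adj G v (ι y)
    nbr-of-v {y} = adj-sym G (ι y) v

  extension-valid : ∀ cv χ → colorDeg G (extend G v cv χ) v ≤ cap cv →
                    (∀ y → colorDeg G (extend G v cv χ) (ι y) ≤ cap (χ y)) → Colorable-1-10 G
  extension-valid cv χ valid-v valid-ι = extend G v cv χ , valid
    where
    valid : ∀ x → colorDeg G (extend G v cv χ) x ≤ cap (extend G v cv χ x)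
    valid x with include-or-v G v x
    ... | inj₁ refl = subst (λ c → colorDeg G (extend G v cv χ) v ≤ cap c) (sym (extend-v G v cv χ)) valid-v
    ... | inj₂ (y , refl) =
      subst (λ c → colorDeg G (extend G v cv χ) (ι y) ≤ cap c) (sym (extend-include G v cv χ y)) (valid-ι y)

  nbrs-all-10 : (∀ y → adj G v (ι y) ≡ true → ψ y ≡ c10) → Colorable-1-10 G
  nbrs-all-10 all-10 = extension-valid c1 ψ valid-v valid-ι
    where
    φ : Fin (n G) → Color
    φ = extend G v c1 ψ
    valid-v : colorDeg G φ v ≤ 1
    valid-v = ≤-trans (≤-reflexive (colorDeg≡0 G v differ)) z≤n
      where
      differ : ∀ u → adj G v u ≡ true → φ u ≢ φ v
      differ u vu with include-or-v G v u
      ... | inj₁ refl = contradiction (trans (sym vu) (irrefl G v)) λ ()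
      ... | inj₂ (y , refl) rewrite extend-include G v c1 ψ y | extend-v G v c1 ψ | all-10 y vu = λ ()
    valid-ι : ∀ y → colorDeg G φ (ι y) ≤ cap (ψ y)
    valid-ι y = begin
      colorDeg G φ (ι y)                                ≡⟨ colorDeg-include G v c1 ψ y ⟩
      𝟙 (adj G (ι y) v ∧ (c1 ==ᶜ ψ y)) + colorDeg H ψ y
        ≡⟨ cong (_+ colorDeg H ψ y) (𝟙-∧-zero (≢⇒==ᶜ ∘ c1≢ψy)) ⟩
      colorDeg H ψ y                                    ≤⟨ ψ-valid y ⟩
      cap (ψ y)                                         ∎
      where
      open ≤-Reasoning
      c1≢ψy : adj G (ι y) v ≡ true → c1 ≢ ψ y
      c1≢ψy yv c1≡ψy = c1≢c10 (trans c1≡ψy (all-10 y (trans (sym nbr-of-v) yv)))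

  module _ (z : Fin (n H)) (vz : adj G v (ι z) ≡ true) (ψz : ψ z ≡ c1) where

    Saturated : Fin (n H) → Set
    Saturated y = adj G v (ι y) ≡ true × ψ y ≡ c10 × 10 ≤ colorDeg H ψ y

    saturated? : ∀ y → Dec (Saturated y)
    saturated? y = (adj G v (ι y) Bool.≟ true) ×-dec (ψ y ≟ᶜ c10) ×-dec (10 ≤? colorDeg H ψ y)

    χ : Fin (n H) → Color
    χ y = if does (saturated? y) then c1 else ψ y

    χ-saturated : ∀ {y} → Saturated y → χ y ≡ c1
    χ-saturated {y} sat rewrite dec-true (saturated? y) sat = refl

    χ-unsaturated : ∀ {y} → ¬ Saturated y → χ y ≡ ψ y
    χ-unsaturated {y} unsat rewrite dec-false (saturated? y) unsat = refl

    nbr-deg-H : ∀ {y} → adj G v (ι y) ≡ true → deg H y ≤ 10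
    nbr-deg-H {y} vy = ℕ.≤-pred (begin
      suc (deg H y)                        ≡⟨ cong (λ b → 𝟙 b + deg H y) (sym (trans nbr-of-v vy)) ⟩
      𝟙 (adj G (ι y) v) + deg H y          ≡⟨ sym (deg-include G v y) ⟩
      deg G (ι y)                          ≤⟨ nbrs-light (ι y) vy ⟩
      11                                   ∎)
      where open ≤-Reasoning

    saturated-nbr : ∀ {y u} → Saturated y → adj H y u ≡ true → ψ u ≡ c10
    saturated-nbr {y} {u} (vy , ψy , full) yu with ψ u ≟ᶜ c10
    ... | yes ψu = ψu
    ... | no ψu≢c10 =
      contradiction (≤-trans full (ℕ.≤-pred (≤-trans (colorDeg<deg H y u yu differ) (nbr-deg-H vy)))) 1+n≰n
      where
      differ : ψ u ≢ ψ y
      differ ψu≡ψy = ψu≢c10 (trans ψu≡ψy ψy)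

    saturated-apart : ∀ {y u} → Saturated y → Saturated u → adj H y u ≢ true
    saturated-apart {y} {u} (vy , _) (vu , _) yu =
      contradiction (trans (sym (proj₁ girth v (ι y) (ι u) vy (trans (sym (deleteVertex-adj G v y u)) yu)))
                           (trans (adj-sym G (ι u) v) vu)) λ ()

    φ : Fin (n G) → Color
    φ = extend G v c10 χ

    valid-v : colorDeg G φ v ≤ 10
    valid-v = ℕ.≤-pred (≤-trans (colorDeg<deg G v (ι z) vz differ) v-light)
      where
      z-unsaturated : ¬ Saturated z
      z-unsaturated (_ , ψz≡c10 , _) = c1≢c10 (trans (sym ψz) ψz≡c10)
      differ : φ (ι z) ≢ φ v
      differ rewrite extend-include G v c10 χ z | extend-v G v c10 χ | χ-unsaturated z-unsaturated | ψz = c1≢c10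

    recoloured-below : ∀ {y} → ¬ Saturated y → colorDeg H χ y ≤ colorDeg H ψ y
    recoloured-below {y} unsat = colorDeg-mono H y same-before
      where
      same-before : ∀ u → adj H y u ≡ true → χ u ≡ χ y → ψ u ≡ ψ y
      same-before u yu χu≡χy with saturated? u
      ... | yes sat-u = contradiction (trans (sym ψy≡c1) (saturated-nbr sat-u (trans (adj-sym H u y) yu))) c1≢c10
        where
        ψy≡c1 : ψ y ≡ c1
        ψy≡c1 = trans (sym (χ-unsaturated unsat)) (trans (sym χu≡χy) (χ-saturated sat-u))
      ... | no unsat-u = trans (sym (χ-unsaturated unsat-u)) (trans χu≡χy (χ-unsaturated unsat))

    valid-saturated : ∀ {y} → Saturated y → colorDeg G φ (ι y) ≤ 1
    valid-saturated {y} sat = ≤-trans (≤-reflexive (begin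
      colorDeg G φ (ι y)                                ≡⟨ colorDeg-include G v c10 χ y ⟩
      𝟙 (adj G (ι y) v ∧ (c10 ==ᶜ χ y)) + colorDeg H χ y
        ≡⟨ cong₂ _+_ (𝟙-∧-zero λ _ → ≢⇒==ᶜ c10≢χy) (colorDeg≡0 H y differ) ⟩
      0                                                 ∎)) z≤n
      where
      open ≡-Reasoning
      c10≢χy : c10 ≢ χ y
      c10≢χy c10≡χy = c1≢c10 (sym (trans c10≡χy (χ-saturated sat)))
      differ : ∀ u → adj H y u ≡ true → χ u ≢ χ y
      differ u yu rewrite χ-saturated sat | χ-unsaturated (λ sat-u → saturated-apart sat sat-u yu)
                        | saturated-nbr sat yu = λ ()

    valid-unsaturated : ∀ {y} → ¬ Saturated y → colorDeg G φ (ι y) ≤ cap (ψ y)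
    valid-unsaturated {y} unsat = begin
      colorDeg G φ (ι y)                                     ≡⟨ colorDeg-include G v c10 χ y ⟩
      𝟙 (adj G (ι y) v ∧ (c10 ==ᶜ χ y)) + colorDeg H χ y     ≤⟨ +-monoʳ-≤ _ (recoloured-below unsat) ⟩
      𝟙 (adj G (ι y) v ∧ (c10 ==ᶜ χ y)) + colorDeg H ψ y     ≤⟨ room (ψ y) refl ⟩
      cap (ψ y)                                              ∎
      where
      open ≤-Reasoning
      room : ∀ c → ψ y ≡ c → 𝟙 (adj G (ι y) v ∧ (c10 ==ᶜ χ y)) + colorDeg H ψ y ≤ cap c
      room c1 ψy≡c1 = subst (λ k → k + colorDeg H ψ y ≤ 1) (sym (𝟙-∧-zero λ _ → ≢⇒==ᶜ c10≢χy))
                            (subst (λ c → colorDeg H ψ y ≤ cap c) ψy≡c1 (ψ-valid y))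
        where
        c10≢χy : c10 ≢ χ y
        c10≢χy c10≡χy = c1≢c10 (sym (trans c10≡χy (trans (χ-unsaturated unsat) ψy≡c1)))
      room c10 ψy≡c10 rewrite nbr-of-v {y} with adj G v (ι y)
      ... | false = subst (λ c → colorDeg H ψ y ≤ cap c) ψy≡c10 (ψ-valid y)
      ... | true = ≤-trans (+-monoˡ-≤ (colorDeg H ψ y) (𝟙-∧-≤ {true}))
                           (≰⇒> λ full → unsat (refl , ψy≡c10 , full))

    valid-ι : ∀ y → colorDeg G φ (ι y) ≤ cap (χ y)
    valid-ι y with saturated? y
    ... | yes sat = subst (λ c → colorDeg G φ (ι y) ≤ cap c) (sym (χ-saturated sat)) (valid-saturated sat)
    ... | no unsat = subst (λ c → colorDeg G φ (ι y) ≤ cap c) (sym (χ-unsaturated unsat)) (valid-unsaturated unsat)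

    some-nbr-1 : Colorable-1-10 G
    some-nbr-1 = extension-valid c10 χ valid-v valid-ι

  colorable : Colorable-1-10 G
  colorable with any? (λ z → (adj G v (ι z) Bool.≟ true) ×-dec (ψ z ≟ᶜ c1))
  ... | yes (z , vz , ψz) = some-nbr-1 z vz ψz
  ... | no none = nbrs-all-10 all-10
    where
    all-10 : ∀ y → adj G v (ι y) ≡ true → ψ y ≡ c10
    all-10 y vy with ψ y in ψy
    ... | c1 = contradiction (y , vy , ψy) none
    ... | c10 = refl

colorable-deleteVertex⇒colorable : (G : Graph) (v : Fin (n G)) → GirthAtLeast5 G → deg G v ≤ 11 →
                                   (∀ u → adj G v u ≡ true → deg G u ≤ 11) →
                                   Colorable-1-10 (deleteVertex G v) → Colorable-1-10 G
colorable-deleteVertex⇒colorable G v girth v-light nbrs-light (ψ , ψ-valid) =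
  ExtendColoring.colorable G v girth v-light nbrs-light ψ ψ-valid

lemma2p2 : (G : Graph) → Bad G → (∀ (H : Graph) → Bad H → n G ≤ n H) →
    ∀ v → deg G v ≤ 11 →
    ∃ λ u → (adj G v u ≡ true) × (12 ≤ deg G u)
lemma2p2 G (planar , girth , uncolorable) minimal v v-light =
  decidable-stable (any? λ u → (adj G v u Bool.≟ true) ×-dec (12 ≤? deg G u)) λ no-heavy-nbr →
    deleteVertex-projectivePlanar G v planar λ planar-H →
      1+n≰n (subst (_≤ n H) (sym (deleteVertex-order G v))
        (minimal H (planar-H , deleteVertex-girth G v girth ,
                    uncolorable ∘ colorable-deleteVertex⇒colorable G v girth v-light (light-nbrs no-heavy-nbr))))
  where
  H : Graph
  H = deleteVertex G v
  light-nbrs : ¬ (∃ λ u → (adj G v u ≡ true) × (12 ≤ deg G u)) → ∀ u → adj G v u ≡ true → deg G u ≤ 11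
  light-nbrs no-heavy-nbr u vu = ℕ.≤-pred (≰⇒> λ heavy → no-heavy-nbr (u , vu , heavy))
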